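{- Let $\alpha>0$. Then (1) $\mathcal{L}_{<\alpha}\setminus\mathcal{L}_{\le\alpha}$ is exactly the class of all graphs without isolated vertices whose average cut-rank equals $\alpha$; and (2) if $G\in\mathcal{L}_{\le\alpha}\setminus\mathcal{L}_{<\alpha}$, then $G$ has a proper vertex-minor $H\in\mathcal{L}_{<\alpha}$ with $\mathbb{E}\rho(H)=\alpha$ and $|V(G)|-|V(H)|\le2$; if $|V(G)|-|V(H)|=2$, then $H$ can be chosen so that $G$ is isomorphic to $H+K_2$.
   Context: Graphs are finite and simple. $\rho_G(X)$ is the binary rank of the $X\times(V(G)\setminus X)$ adjacency submatrix; $\mathbb{E}\rho(G)=2^{ -|V(G)|}\sum_{S\subseteq V(G)}\rho_G(S)$. Local complementation at $v$ complements the induced subgraph on the neighborhood of $v$; $H$ is a vertex-minor of $G$ if $H$ is an induced subgraph of a graph obtained from $G$ by local complementations; a proper vertex-minor is one with fewer vertices or otherwise different from $G$ (obtained using at least one deletion). For real $\alpha$, $\mathcal{L}_{\le\alpha}$ is the class of graphs $H$ with $\mathbb{E}\rho(H)>\alpha$ such that every proper vertex-minor of $H$ has average cut-rank at most $\alpha$, and $\mathcal{L}_{<\alpha}$ is the class of graphs $H$ with $\mathbb{E}\rho(H)\ge\alpha$ such that every proper vertex-minor of $H$ has average cut-rank smaller than $\alpha$. $H+K_2$ is the disjoint union of $H$ and an edge.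
   Formalization: The parameter α ranges over the positive rationals rather than the positive reals. -}

module Defs where

open import Data.Bool using (Bool; true; false; _xor_; _∧_; _∨_; not; if_then_else_)
open import Data.Nat using (ℕ; zero; suc; _+_; _^_; _⊔_; _<_)
open import Data.Nat.Properties using (m^n≢0)
open import Data.Integer using (+_)
open import Data.Rational using (ℚ; _/_)
open import Data.Fin using (Fin; _≟_; splitAt)
open import Data.Fin.Subset using (Subset; Side; inside; outside)
open import Data.Vec using (Vec; []; _∷_; lookup)
open import Data.List using (List; []; _∷_; _++_; map; foldr; zipWith; replicate; length; null; allFin; concatMap)
open import Data.Nat.ListAction using (sum)
open import Data.Rational using () renaming (_<_ to _<ℚ_; _≤_ to _≤ℚ_)
open import Data.Sum using (_⊎_; inj₁; inj₂)
open import Data.Product using (Σ; _×_; ∃; ∃-syntax)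
open import Function.Definitions using (Injective)
open import Function.Bundles using (_↔_; Inverse)
open import Relation.Binary.PropositionalEquality using (_≡_)
open import Relation.Nullary using (does)

record Graph (n : ℕ) : Set where
  field
    adj    : Fin n → Fin n → Bool
    sym    : ∀ i j → adj i j ≡ adj j i
    irrefl : ∀ i → adj i i ≡ false
open Graph public

Adj : ℕ → Set
Adj n = Fin n → Fin n → Bool

sublists : {A : Set} → List A → List (List A)
sublists []       = [] ∷ []
sublists (x ∷ xs) = map (x ∷_) (sublists xs) ++ sublists xs

vsum : ℕ → List (List Bool) → List Bool
vsum m = foldr (zipWith _xor_) (replicate m false)

allB : {A : Set} → (A → Bool) → List A → Bool
allB p = foldr (λ x acc → p x ∧ acc) true

isZeroVec : List Bool → Bool
isZeroVec = allB not

independent : ℕ → List (List Bool) → Bool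
independent m R = allB (λ S → null S ∨ not (isZeroVec (vsum m S))) (sublists R)

rank2 : ℕ → List (List Bool) → ℕ
rank2 m R = foldr (λ S acc → if independent m S then length S ⊔ acc else acc) 0 (sublists R)

isIn : {n : ℕ} → Subset n → Fin n → Bool
isIn X i with lookup X i
... | inside  = true
... | outside = false

select : {n : ℕ} → (Fin n → Bool) → List (Fin n)
select {n} P = foldr (λ i acc → if P i then i ∷ acc else acc) [] (allFin n)

cutRank : {n : ℕ} → Graph n → Subset n → ℕ
cutRank G X =
  let rows = select (isIn X)
      cols = select (λ i → not (isIn X i))
  in rank2 (length cols) (map (λ x → map (λ y → adj G x y) cols) rows)

allSubsets : (n : ℕ) → List (Subset n)
allSubsets zero    = [] ∷ []
allSubsets (suc n) = concatMap (λ p → (outside ∷ p) ∷ (inside ∷ p) ∷ []) (allSubsets n)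

avgCutRank : {n : ℕ} → Graph n → ℚ
avgCutRank {n} G = _/_ (+ sum (map (cutRank G) (allSubsets n))) (2 ^ n) {{m^n≢0 2 n}}

localComp : {n : ℕ} → Adj n → Fin n → Adj n
localComp A v i j = if does (i ≟ j) then A i j else (A i j xor (A v i ∧ A v j))

data LocallyEquiv {n : ℕ} (A : Adj n) : Adj n → Set where
  le-refl : LocallyEquiv A A
  le-step : ∀ {B} → LocallyEquiv A B → (v : Fin n) → LocallyEquiv A (localComp B v)

VertexMinor : {m n : ℕ} → Graph m → Graph n → Set
VertexMinor {m} {n} H G =
  ∃[ B ] LocallyEquiv (adj G) B ×
    (∃[ f ] Injective _≡_ _≡_ f × (∀ i j → adj H i j ≡ B (f i) (f j)))

ProperVertexMinor : {m n : ℕ} → Graph m → Graph n → Set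
ProperVertexMinor {m} {n} H G = m < n × VertexMinor H G

NoIsolated : {n : ℕ} → Graph n → Set
NoIsolated {n} G = ∀ v → ∃[ w ] adj G v w ≡ true

plusK2 : {m : ℕ} → Graph m → Adj (m + 2)
plusK2 {m} H i j with splitAt m i | splitAt m j
... | inj₁ a | inj₁ b = adj H a b
... | inj₂ a | inj₂ b = not (does (a ≟ b))
... | inj₁ _ | inj₂ _ = false
... | inj₂ _ | inj₁ _ = false

IsoTo : {n k : ℕ} → Graph n → Adj k → Set
IsoTo {n} {k} G B =
  Σ (Fin n ↔ Fin k) (λ f → ∀ i j → adj G i j ≡ B (Inverse.to f i) (Inverse.to f j))

InLe : ℚ → {n : ℕ} → Graph n → Set
InLe α G = α <ℚ avgCutRank G × (∀ m (H : Graph m) → ProperVertexMinor H G → avgCutRank H ≤ℚ α)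

InLt : ℚ → {n : ℕ} → Graph n → Set
InLt α G = α ≤ℚ avgCutRank G × (∀ m (H : Graph m) → ProperVertexMinor H G → avgCutRank H <ℚ α)

{-# OPTIONS --safe #-}
-- Cut-rank never increases under local complementation (adding a fixed row to
-- some rows of the cut matrix, or applying one additive map to all rows) nor
-- under taking induced subgraphs.  Averaged over all 2ⁿ cuts this shows that
-- deleting a vertex never increases 𝔼ρ, strictly decreases it when the vertex
-- has a neighbour (the cut {v} loses its rank), and does not decrease it when
-- the vertex is isolated.  As every proper vertex-minor of G is an induced
-- subgraph of a one-vertex deletion of a graph locally equivalent to G, this
-- gives (1).
-- For (2), some deletion B ─ v of a graph B locally equivalent to G has
-- 𝔼ρ(B ─ v) = α; it is found by a finite search, because by the pigeonhole
-- principle every graph locally equivalent to G is reached in at most (2ⁿ)ⁿ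
-- steps.  If B ─ v has no isolated vertex it is the required minor by (1).
-- Otherwise an isolated vertex u of B ─ v is adjacent to v alone in B, and v to
-- u alone, since another neighbour of v would give α ≤ 𝔼ρ(B ─ u ─ v) < 𝔼ρ(B ─ u) ≤ α.
-- So uv is a K₂ component of B, hence of G, and H = G minus u and v works.

module Submission where

open import Algebra.Bundles using (CommutativeSemigroup)
import Algebra.Properties.CommutativeSemigroup as CommutativeSemigroupProperties
import Data.Bool as Bool
open import Data.Bool using (Bool; true; false; not; _∧_; _∨_; _xor_; if_then_else_)
open import Data.Bool.Properties
  using (xor-comm; xor-assoc; xor-identityˡ; xor-identityʳ; xor-same; ∧-comm; ∧-zeroʳ; ¬-not)
open import Data.Empty using (⊥-elim)
open import Data.Fin using (Fin; zero; suc; toℕ; _≟_; punchIn; punchOut; splitAt; join; _↑ˡ_; _↑ʳ_; funToFin; finToFun)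
open import Data.Fin.Properties
  using ( any?; all?; pigeonhole; injective⇒≤; toℕ≤pred[n]; finToFun-funToFin
        ; punchIn-punchOut; punchInᵢ≢i; punchIn-injective; punchOut-injective
        ; splitAt-↑ˡ; splitAt-↑ʳ; join-splitAt )
open import Data.Fin.Subset using (Subset; outside; inside; ⁅_⁆)
open import Data.Fin.Subset.Properties using (x∈⁅x⁆; x∈⁅y⁆⇒x≡y)
open import Data.Integer as ℤ using (+_)
import Data.Integer.Properties as ℤP
import Data.List as List
open import Data.List using (List; []; _∷_; _++_; map; foldr; length; take; drop; concatMap; allFin)
open import Data.List.Membership.Propositional using (_∈_)
open import Data.List.Membership.Propositional.Properties
  using (∈-++⁺ˡ; ∈-++⁺ʳ; ∈-++⁻; ∈-map⁺; ∈-map⁻; ∈-concatMap⁺; ∈-allFin)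
import Data.List.Properties as ListP
open import Data.List.Relation.Unary.All as All using (All; []; _∷_)
import Data.List.Relation.Unary.All.Properties as AllP
open import Data.List.Relation.Unary.Any as Any using (here; there; satisfied)
open import Data.Maybe using (Maybe; just; nothing)
open import Data.Nat as ℕ using (ℕ; zero; suc; _+_; _*_; _^_; _∸_; _⊔_; _≤_; z≤n; s≤s; NonZero)
open import Data.Nat.ListAction using (sum)
import Data.Nat.Properties as ℕₚ
open import Data.Nat.Properties
  using ( ≤-refl; ≤-trans; ≤-antisym; ≤-pred; ≰⇒>; <⇒≱; n<1+n; m≤n⇒m≤1+n
        ; m≤m⊔n; m≤n⊔m; ⊔-sel; m⊓n≤m; m+[n∸m]≡n; m+n∸n≡m
        ; +-assoc; +-mono-≤; +-mono-<-≤; +-mono-≤-<; +-monoˡ-≤; *-monoˡ-≤; *-monoˡ-<; m^n≢0 )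
open import Data.Nat.Tactic.RingSolver using (solve-∀)
open import Data.Product using (Σ; Σ-syntax; ∃; ∃-syntax; _×_; _,_; proj₁; proj₂)
open import Data.Rational as ℚ using (ℚ; 0ℚ; _<_; _/_; toℚᵘ)
import Data.Rational.Properties as ℚₚ
open import Data.Rational.Properties using (toℚᵘ-cancel-≤; toℚᵘ-cancel-<; toℚᵘ-fromℚᵘ)
import Data.Rational.Unnormalised as ℚᵘ
import Data.Rational.Unnormalised.Properties as ℚᵘP
open import Data.Sum using (_⊎_; inj₁; inj₂; [_,_]′; map₂)
open import Data.Unit using (⊤; tt)
open import Data.Vec as Vec using (Vec; []; _∷_; toList; fromList; lookup; tabulate; insertAt)
import Data.Vec.Properties as VecP
open import Function using (_∘_; id)
open import Function.Bundles using (_⇔_; mk⇔; mk↔ₛ′)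
open import Function.Definitions using (Injective)
open import Relation.Nullary using (¬_; Dec; yes; no; does; ¬?; contradiction)
open import Relation.Nullary.Decidable using (dec-true; dec-false)
open import Relation.Binary.PropositionalEquality
open import Relation.Binary.PropositionalEquality.Algebra using (isMagma)

open import Defs hiding (sym)

private variable
  k m n : ℕ

-- Row vectors over GF(2)

infixl 6 _⊕_

_⊕_ : Vec Bool k → Vec Bool k → Vec Bool k
_⊕_ = Vec.zipWith _xor_

𝟘 : Vec Bool k
𝟘 = Vec.replicate _ false

⊕-comm : (x y : Vec Bool k) → x ⊕ y ≡ y ⊕ x
⊕-comm = VecP.zipWith-comm xor-comm

⊕-assoc : (x y z : Vec Bool k) → (x ⊕ y) ⊕ z ≡ x ⊕ (y ⊕ z)
⊕-assoc = VecP.zipWith-assoc xor-assoc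

⊕-identityˡ : (x : Vec Bool k) → 𝟘 ⊕ x ≡ x
⊕-identityˡ = VecP.zipWith-identityˡ xor-identityˡ

⊕-identityʳ : (x : Vec Bool k) → x ⊕ 𝟘 ≡ x
⊕-identityʳ = VecP.zipWith-identityʳ xor-identityʳ

⊕-self : (x : Vec Bool k) → x ⊕ x ≡ 𝟘
⊕-self []      = refl
⊕-self (a ∷ x) = cong₂ _∷_ (xor-same a) (⊕-self x)

⊕-cancelˡ : (x y : Vec Bool k) → x ⊕ (x ⊕ y) ≡ y
⊕-cancelˡ x y = begin
  x ⊕ (x ⊕ y) ≡⟨ ⊕-assoc x x y ⟨
  x ⊕ x ⊕ y   ≡⟨ cong (_⊕ y) (⊕-self x) ⟩
  𝟘 ⊕ y       ≡⟨ ⊕-identityˡ y ⟩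
  y           ∎
  where open ≡-Reasoning

⊕-commutativeSemigroup : ℕ → CommutativeSemigroup _ _
⊕-commutativeSemigroup k = record
  { Carrier                = Vec Bool k
  ; _≈_                    = _≡_
  ; _∙_                    = _⊕_
  ; isCommutativeSemigroup = record
    { isSemigroup = record { isMagma = isMagma _⊕_ ; assoc = ⊕-assoc }
    ; comm        = ⊕-comm
    }
  }

module _ {k : ℕ} where
  open CommutativeSemigroupProperties (⊕-commutativeSemigroup k) public
    using () renaming (interchange to ⊕-interchange; x∙yz≈y∙xz to ⊕-leftComm)

⊕-cancel-interchange : (a x y : Vec Bool k) → (a ⊕ x) ⊕ (a ⊕ y) ≡ x ⊕ y
⊕-cancel-interchange a x y = begin
  (a ⊕ x) ⊕ (a ⊕ y) ≡⟨ ⊕-interchange a x a y ⟩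
  (a ⊕ a) ⊕ (x ⊕ y) ≡⟨ cong (_⊕ (x ⊕ y)) (⊕-self a) ⟩
  𝟘 ⊕ (x ⊕ y)       ≡⟨ ⊕-identityˡ (x ⊕ y) ⟩
  x ⊕ y             ∎
  where open ≡-Reasoning

infixr 7 _·_

_·_ : Bool → Vec Bool k → Vec Bool k
true  · w = w
false · w = 𝟘

·-xor : (a b : Bool) (w : Vec Bool k) → (a xor b) · w ≡ a · w ⊕ b · w
·-xor false false w = sym (⊕-identityˡ 𝟘)
·-xor false true  w = sym (⊕-identityˡ w)
·-xor true  false w = sym (⊕-identityʳ w)
·-xor true  true  w = sym (⊕-self w)

map-xor : {A : Set} (f g : A → Bool) (xs : Vec A k) →
          Vec.map (λ y → f y xor g y) xs ≡ Vec.map f xs ⊕ Vec.map g xs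
map-xor f g []       = refl
map-xor f g (x ∷ xs) = cong (_ ∷_) (map-xor f g xs)

Span : List (Vec Bool k) → Vec Bool k → Set
Span []      y = y ≡ 𝟘
Span (b ∷ B) y = Span B y ⊎ Span B (b ⊕ y)

span-resp : ∀ {B : List (Vec Bool k)} {x y} → x ≡ y → Span B x → Span B y
span-resp refl s = s

span-𝟘 : (B : List (Vec Bool k)) → Span B 𝟘
span-𝟘 []      = refl
span-𝟘 (b ∷ B) = inj₁ (span-𝟘 B)

span-⊕ : (B : List (Vec Bool k)) {x y : Vec Bool k} → Span B x → Span B y → Span B (x ⊕ y)
span-⊕ []      refl     refl     = ⊕-identityˡ 𝟘
span-⊕ (b ∷ B)          (inj₁ p) (inj₁ q) = inj₁ (span-⊕ B p q)
span-⊕ (b ∷ B) {x} {y}  (inj₁ p) (inj₂ q) = inj₂ (span-resp (⊕-leftComm x b y) (span-⊕ B p q))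
span-⊕ (b ∷ B) {x} {y}  (inj₂ p) (inj₁ q) = inj₂ (span-resp (⊕-assoc b x y) (span-⊕ B p q))
span-⊕ (b ∷ B) {x} {y}  (inj₂ p) (inj₂ q) = inj₁ (span-resp (⊕-cancel-interchange b x y) (span-⊕ B p q))

span-∈ : ∀ {B : List (Vec Bool k)} {x} → x ∈ B → Span B x
span-∈ {B = b ∷ B} (here refl) = inj₂ (span-resp (sym (⊕-self b)) (span-𝟘 B))
span-∈             (there x∈B) = inj₁ (span-∈ x∈B)

span-trans : ∀ {C} (B : List (Vec Bool k)) {y} → All (Span C) B → Span B y → Span C y
span-trans {C = C} []      []         refl     = span-𝟘 C
span-trans         (b ∷ B) (_  ∷ sps) (inj₁ s) = span-trans B sps s
span-trans {C = C} (b ∷ B) {y} (sb ∷ sps) (inj₂ s) =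
  span-resp (⊕-cancelˡ b y) (span-⊕ C sb (span-trans B sps s))

span? : (B : List (Vec Bool k)) (y : Vec Bool k) → Dec (Span B y)
span? []      y = VecP.≡-dec Bool._≟_ y 𝟘
span? (b ∷ B) y with span? B y | span? B (b ⊕ y)
... | yes p | _     = yes (inj₁ p)
... | no _  | yes q = yes (inj₂ q)
... | no ¬p | no ¬q = no λ { (inj₁ p) → ¬p p ; (inj₂ q) → ¬q q }

span-· : ∀ (B : List (Vec Bool k)) a {w} → Span B w → Span B (a · w)
span-· B true  w∈B = w∈B
span-· B false _   = span-𝟘 B

span-remove : ∀ (P : List (Vec Bool k)) {b Q y} →
              Span (P ++ b ∷ Q) y → Span (P ++ Q) y ⊎ Span (P ++ Q) (b ⊕ y)
span-remove []      s        = s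
span-remove (p ∷ P) (inj₁ s) with span-remove P s
... | inj₁ t = inj₁ (inj₁ t)
... | inj₂ t = inj₂ (inj₁ t)
span-remove (p ∷ P) {b} {y = y} (inj₂ s) with span-remove P s
... | inj₁ t = inj₁ (inj₂ t)
... | inj₂ t = inj₂ (inj₂ (span-resp (⊕-leftComm b p y) t))

Independent : List (Vec Bool k) → Set
Independent []      = ⊤
Independent (s ∷ S) = ¬ Span S s × Independent S

basis : (R : List (Vec Bool k)) →
        Σ[ B ∈ List (Vec Bool k) ] B ∈ sublists R × Independent B × All (Span B) R
basis []      = [] , here refl , tt , []
basis (r ∷ R) with basis R
... | B , B⊆R , indB , spansR with span? B r
...   | yes r∈B = B , ∈-++⁺ʳ (map (r ∷_) (sublists R)) B⊆R , indB , r∈B ∷ spansR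
...   | no  r∉B = r ∷ B , ∈-++⁺ˡ (∈-map⁺ (r ∷_) B⊆R) , (r∉B , indB) ,
                  span-∈ (here refl) ∷ All.map inj₁ spansR

pivot : (B : List (Vec Bool k)) {s : Vec Bool k} → s ≢ 𝟘 → Span B s →
        ∃[ P ] ∃[ b ] ∃[ Q ] B ≡ P ++ b ∷ Q × Span (P ++ Q) (b ⊕ s)
pivot []      s≢𝟘 s∈B      = ⊥-elim (s≢𝟘 s∈B)
pivot (b ∷ B) s≢𝟘 (inj₂ s) = [] , b , B , refl , s
pivot (b ∷ B) s≢𝟘 (inj₁ s) with pivot B s≢𝟘 s
... | P , c , Q , refl , t = b ∷ P , c , Q , refl , inj₁ t

independent-shear : ∀ {s} (g : Vec Bool k → Vec Bool k) → (∀ x → g x ≡ x ⊎ g x ≡ s ⊕ x) →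
                    ∀ S → Independent (s ∷ S) → Independent (map g S)
independent-shear             g g-cases []      _                      = tt
independent-shear {s = s} g g-cases (t ∷ T) (s∉tT , t∉T , indT) =
  g-t∉gT (g-cases t) , independent-shear g g-cases T (s∉tT ∘ inj₁ , indT)
  where
  s⊕t∉T : ¬ Span T (s ⊕ t)
  s⊕t∉T st = s∉tT (inj₂ (span-resp (⊕-comm s t) st))
  gT⊆sT : All (Span (s ∷ T)) (map g T)
  gT⊆sT = AllP.map⁺ (All.tabulate λ {x} x∈T → in-span x (there x∈T) (g-cases x))
    where
    in-span : ∀ x → x ∈ s ∷ T → g x ≡ x ⊎ g x ≡ s ⊕ x → Span (s ∷ T) (g x)
    in-span x x∈sT (inj₁ eq) = span-resp (sym eq) (span-∈ x∈sT)
    in-span x x∈sT (inj₂ eq) = span-resp (sym eq) (span-⊕ (s ∷ T) (span-∈ (here refl)) (span-∈ x∈sT))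
  g-t∉gT : g t ≡ t ⊎ g t ≡ s ⊕ t → ¬ Span (map g T) (g t)
  g-t∉gT cases gt∈gT with cases | span-trans (map g T) gT⊆sT gt∈gT
  ... | inj₁ eq | inj₁ p = t∉T (span-resp eq p)
  ... | inj₁ eq | inj₂ p = s⊕t∉T (span-resp (cong (s ⊕_) eq) p)
  ... | inj₂ eq | inj₁ p = s⊕t∉T (span-resp eq p)
  ... | inj₂ eq | inj₂ p = t∉T (span-resp (trans (cong (s ⊕_) eq) (⊕-cancelˡ s t)) p)

-- The induction is on the length of S: the exchange step replaces S by a
-- list of the same length inside a spanning list with one element fewer.
independent-length-≤ : ∀ n (S B : List (Vec Bool k)) → length S ≡ n →
                       Independent S → All (Span B) S → n ≤ length B
independent-length-≤ zero    S       B _   _              _            = z≤n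
independent-length-≤ (suc n) (s ∷ S) B len (s∉S , indS) (s∈B ∷ S⊆B)
  with pivot B (λ s≡𝟘 → s∉S (span-resp (sym s≡𝟘) (span-𝟘 S))) s∈B
... | P , b , Q , refl , b⊕s∈PQ =
  subst (suc n ≤_) (sym (ListP.length-++-sucʳ P b Q))
    (s≤s (independent-length-≤ n (map g S) (P ++ Q)
            (trans (ListP.length-map g S) (cong ℕ.pred len))
            (independent-shear g g-cases S (s∉S , indS))
            (AllP.map⁺ (All.map g-in-PQ S⊆B))))
  where
  g : Vec Bool _ → Vec Bool _
  g x with span? (P ++ Q) x
  ... | yes _ = x
  ... | no  _ = s ⊕ x
  g-cases : ∀ x → g x ≡ x ⊎ g x ≡ s ⊕ x
  g-cases x with span? (P ++ Q) x
  ... | yes _ = inj₁ refl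
  ... | no  _ = inj₂ refl
  g-in-PQ : ∀ {x} → Span (P ++ b ∷ Q) x → Span (P ++ Q) (g x)
  g-in-PQ {x} x∈B with span? (P ++ Q) x
  ... | yes x∈PQ = x∈PQ
  ... | no  x∉PQ with span-remove P x∈B
  ...   | inj₁ x∈PQ   = ⊥-elim (x∉PQ x∈PQ)
  ...   | inj₂ b⊕x∈PQ = span-resp (⊕-cancel-interchange b s x) (span-⊕ (P ++ Q) b⊕s∈PQ b⊕x∈PQ)

⨁ : List (Vec Bool k) → Vec Bool k
⨁ = foldr _⊕_ 𝟘

sublists-map : ∀ {A B : Set} (f : A → B) (R : List A) →
               sublists (map f R) ≡ map (map f) (sublists R)
sublists-map f []      = refl
sublists-map f (x ∷ R) = begin
  map (f x ∷_) (sublists (map f R)) ++ sublists (map f R)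
    ≡⟨ cong (λ L → map (f x ∷_) L ++ L) (sublists-map f R) ⟩
  map (f x ∷_) (map (map f) L) ++ map (map f) L
    ≡⟨ cong (_++ map (map f) L) (trans (sym (ListP.map-∘ L)) (ListP.map-∘ L)) ⟩
  map (map f) (map (x ∷_) L) ++ map (map f) L
    ≡⟨ ListP.map-++ (map f) (map (x ∷_) L) L ⟨
  map (map f) (map (x ∷_) L ++ L) ∎
  where
  open ≡-Reasoning
  L = sublists R

[]∈sublists : ∀ {A : Set} (R : List A) → [] ∈ sublists R
[]∈sublists []      = here refl
[]∈sublists (x ∷ R) = ∈-++⁺ʳ (map (x ∷_) (sublists R)) ([]∈sublists R)

[-]∈sublists : ∀ {A : Set} {R : List A} {x} → x ∈ R → (x ∷ []) ∈ sublists R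
[-]∈sublists {R = y ∷ R} (here refl) = ∈-++⁺ˡ (∈-map⁺ (y ∷_) ([]∈sublists R))
[-]∈sublists {R = y ∷ R} (there x∈R) = ∈-++⁺ʳ (map (y ∷_) (sublists R)) ([-]∈sublists x∈R)

All-sublist : ∀ {A : Set} {P : A → Set} (R : List A) {T} → T ∈ sublists R → All P R → All P T
All-sublist []      (here refl) []       = []
All-sublist (x ∷ R) T∈         (px ∷ pR) with ∈-++⁻ (map (x ∷_) (sublists R)) T∈
... | inj₂ T∈R = All-sublist R T∈R pR
... | inj₁ T∈xR with ∈-map⁻ (x ∷_) T∈xR
...   | T , T∈R , refl = px ∷ All-sublist R T∈R pR

sublist-span : (S : List (Vec Bool k)) {T : List (Vec Bool k)} → T ∈ sublists S → Span S (⨁ T)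
sublist-span []      (here refl) = refl
sublist-span (s ∷ S) T∈         with ∈-++⁻ (map (s ∷_) (sublists S)) T∈
... | inj₂ T∈S = inj₁ (sublist-span S T∈S)
... | inj₁ T∈sS with ∈-map⁻ (s ∷_) T∈sS
...   | T , T∈S , refl = inj₂ (span-resp (sym (⊕-cancelˡ s (⨁ T))) (sublist-span S T∈S))

span-sublist : (S : List (Vec Bool k)) {y : Vec Bool k} → Span S y →
               ∃[ T ] T ∈ sublists S × ⨁ T ≡ y
span-sublist []      y≡𝟘      = [] , here refl , sym y≡𝟘
span-sublist (s ∷ S) (inj₁ y∈S) with span-sublist S y∈S
... | T , T∈S , refl = T , ∈-++⁺ʳ (map (s ∷_) (sublists S)) T∈S , refl
span-sublist (s ∷ S) {y} (inj₂ s⊕y∈S) with span-sublist S s⊕y∈S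
... | T , T∈S , ⨁T≡s⊕y =
  s ∷ T , ∈-++⁺ˡ (∈-map⁺ (s ∷_) T∈S) , trans (cong (s ⊕_) ⨁T≡s⊕y) (⊕-cancelˡ s y)

allB-true⇒ : ∀ {A : Set} (p : A → Bool) xs → allB p xs ≡ true → ∀ {x} → x ∈ xs → p x ≡ true
allB-true⇒ p (y ∷ xs) eq x∈ with p y in py | x∈
... | true | here refl = py
... | true | there x∈xs = allB-true⇒ p xs eq x∈xs

allB-true⇐ : ∀ {A : Set} (p : A → Bool) xs → (∀ {x} → x ∈ xs → p x ≡ true) → allB p xs ≡ true
allB-true⇐ p []       _   = refl
allB-true⇐ p (x ∷ xs) all rewrite all (here refl) = allB-true⇐ p xs (all ∘ there)

allB-++ : ∀ {A : Set} (p : A → Bool) xs ys → allB p (xs ++ ys) ≡ allB p xs ∧ allB p ys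
allB-++ p []       ys = refl
allB-++ p (x ∷ xs) ys with p x
... | true  = allB-++ p xs ys
... | false = refl

allB-map : ∀ {A B : Set} (p : B → Bool) (f : A → B) xs → allB p (map f xs) ≡ allB (p ∘ f) xs
allB-map p f []       = refl
allB-map p f (x ∷ xs) = cong (p (f x) ∧_) (allB-map p f xs)

allB-cong : ∀ {A : Set} {p q : A → Bool} → (∀ x → p x ≡ q x) → ∀ xs → allB p xs ≡ allB q xs
allB-cong p≗q []       = refl
allB-cong p≗q (x ∷ xs) = cong₂ _∧_ (p≗q x) (allB-cong p≗q xs)

isZeroVec-toList : (v : Vec Bool k) → isZeroVec (toList v) ≡ true → v ≡ 𝟘
isZeroVec-toList []          _  = refl
isZeroVec-toList (false ∷ v) eq = cong (false ∷_) (isZeroVec-toList v eq)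

isZeroVec-𝟘 : ∀ k → isZeroVec (toList (𝟘 {k})) ≡ true
isZeroVec-𝟘 zero    = refl
isZeroVec-𝟘 (suc k) = isZeroVec-𝟘 k

toList-⊕ : (x y : Vec Bool k) → toList (x ⊕ y) ≡ List.zipWith _xor_ (toList x) (toList y)
toList-⊕ []      []      = refl
toList-⊕ (a ∷ x) (b ∷ y) = cong ((a xor b) ∷_) (toList-⊕ x y)

vsum-toList : (T : List (Vec Bool k)) → vsum k (map toList T) ≡ toList (⨁ T)
vsum-toList {k} []      = sym (VecP.toList-replicate k false)
vsum-toList     (t ∷ T) = begin
  List.zipWith _xor_ (toList t) (vsum _ (map toList T))
    ≡⟨ cong (List.zipWith _xor_ (toList t)) (vsum-toList T) ⟩
  List.zipWith _xor_ (toList t) (toList (⨁ T))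
    ≡⟨ toList-⊕ t (⨁ T) ⟨
  toList (t ⊕ ⨁ T) ∎
  where open ≡-Reasoning

independent-∷ : (s : Vec Bool k) (S : List (Vec Bool k)) →
  independent k (map toList (s ∷ S)) ≡
  allB (λ T → not (isZeroVec (toList (s ⊕ ⨁ T)))) (sublists S) ∧ independent k (map toList S)
independent-∷ {k} s S = begin
  allB p (map (toList s ∷_) L ++ L)
    ≡⟨ allB-++ p (map (toList s ∷_) L) L ⟩
  allB p (map (toList s ∷_) L) ∧ allB p L
    ≡⟨ cong (_∧ allB p L) (allB-map p (toList s ∷_) L) ⟩
  allB (p ∘ (toList s ∷_)) L ∧ allB p L
    ≡⟨ cong (λ L′ → allB (p ∘ (toList s ∷_)) L′ ∧ allB p L) (sublists-map toList S) ⟩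
  allB (p ∘ (toList s ∷_)) (map (map toList) (sublists S)) ∧ allB p L
    ≡⟨ cong (_∧ allB p L) (allB-map (p ∘ (toList s ∷_)) (map toList) (sublists S)) ⟩
  allB (p ∘ (toList s ∷_) ∘ map toList) (sublists S) ∧ allB p L
    ≡⟨ cong (_∧ allB p L) (allB-cong summand (sublists S)) ⟩
  allB (λ T → not (isZeroVec (toList (s ⊕ ⨁ T)))) (sublists S) ∧ allB p L ∎
  where
  open ≡-Reasoning
  p : List (List Bool) → Bool
  p T = List.null T ∨ not (isZeroVec (vsum k T))
  L = sublists (map toList S)
  summand : ∀ T → p (toList s ∷ map toList T) ≡ not (isZeroVec (toList (s ⊕ ⨁ T)))
  summand T = cong (λ v → not (isZeroVec v))
    (trans (cong (List.zipWith _xor_ (toList s)) (vsum-toList T)) (sym (toList-⊕ s (⨁ T))))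

∧-true : ∀ {a b} → a ∧ b ≡ true → a ≡ true × b ≡ true
∧-true {true} {true} _ = refl , refl

nonzero-test⇒ : (v : Vec Bool k) → not (isZeroVec (toList v)) ≡ true → v ≢ 𝟘
nonzero-test⇒ {k} v eq refl with () ← trans (sym eq) (cong not (isZeroVec-𝟘 k))

nonzero-test⇐ : (v : Vec Bool k) → v ≢ 𝟘 → not (isZeroVec (toList v)) ≡ true
nonzero-test⇐ v v≢𝟘 with isZeroVec (toList v) in eq
... | false = refl
... | true  = ⊥-elim (v≢𝟘 (isZeroVec-toList v eq))

independent⇒Independent : (S : List (Vec Bool k)) → independent k (map toList S) ≡ true → Independent S
independent⇒Independent []      _   = tt
independent⇒Independent (s ∷ S) ind with ∧-true (trans (sym (independent-∷ s S)) ind)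
... | s∉sums , indS = s∉S , independent⇒Independent S indS
  where
  s∉S : ¬ Span S s
  s∉S s∈S with span-sublist S s∈S
  ... | T , T∈S , ⨁T≡s = nonzero-test⇒ (s ⊕ ⨁ T) (allB-true⇒ _ (sublists S) s∉sums T∈S)
                           (trans (cong (s ⊕_) ⨁T≡s) (⊕-self s))

Independent⇒independent : (S : List (Vec Bool k)) → Independent S → independent k (map toList S) ≡ true
Independent⇒independent []      _            = refl
Independent⇒independent (s ∷ S) (s∉S , indS) =
  trans (independent-∷ s S)
        (cong₂ _∧_ (allB-true⇐ _ (sublists S) s∉sums) (Independent⇒independent S indS))
  where
  s∉sums : ∀ {T} → T ∈ sublists S → not (isZeroVec (toList (s ⊕ ⨁ T))) ≡ true
  s∉sums {T} T∈S = nonzero-test⇐ (s ⊕ ⨁ T) λ s⊕⨁T≡𝟘 →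
    s∉S (span-resp (trans (sym (⊕-cancelˡ s (⨁ T))) (trans (cong (s ⊕_) s⊕⨁T≡𝟘) (⊕-identityʳ s)))
                   (sublist-span S T∈S))

rank : List (Vec Bool k) → ℕ
rank {k} R = rank2 k (map toList R)

-- `rank2 m R` unfolds to `maxIndependent m (sublists R)`.
private
  maxIndependent : ℕ → List (List (List Bool)) → ℕ
  maxIndependent m = foldr (λ S acc → if independent m S then length S ⊔ acc else acc) 0

  maxIndependent-≥ : ∀ L {S} → S ∈ L → independent m S ≡ true → length S ≤ maxIndependent m L
  maxIndependent-≥ (S ∷ L) (here refl) ind rewrite ind = m≤m⊔n (length S) _
  maxIndependent-≥ {m} (S′ ∷ L) (there S∈L) ind with independent m S′
  ... | true  = ≤-trans (maxIndependent-≥ L S∈L ind) (m≤n⊔m (length S′) _)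
  ... | false = maxIndependent-≥ L S∈L ind

  maxIndependent-attained : ∀ L → maxIndependent m L ≡ 0 ⊎
    ∃[ S ] S ∈ L × independent m S ≡ true × length S ≡ maxIndependent m L
  maxIndependent-attained []  = inj₁ refl
  maxIndependent-attained {m} (S ∷ L) with independent m S in ind | maxIndependent-attained L
  ... | false | inj₁ eq                    = inj₁ eq
  ... | false | inj₂ (S′ , S′∈L , indS′ , len) = inj₂ (S′ , there S′∈L , indS′ , len)
  ... | true  | rec with ⊔-sel (length S) (maxIndependent m L) | rec
  ...   | inj₁ eq | _                        = inj₂ (S , here refl , ind , sym eq)
  ...   | inj₂ eq | inj₁ eq₀                 = inj₁ (trans eq eq₀)
  ...   | inj₂ eq | inj₂ (S′ , S′∈L , indS′ , len) = inj₂ (S′ , there S′∈L , indS′ , trans len (sym eq))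

rank-≥ : (R : List (Vec Bool k)) {S : List (Vec Bool k)} →
         S ∈ sublists R → Independent S → length S ≤ rank R
rank-≥ R {S} S∈R indS = subst (_≤ rank R) (ListP.length-map toList S)
  (maxIndependent-≥ (sublists (map toList R))
     (subst (map toList S ∈_) (sym (sublists-map toList R)) (∈-map⁺ (map toList) S∈R))
     (Independent⇒independent S indS))

rank-attained : (R : List (Vec Bool k)) →
                ∃[ S ] S ∈ sublists R × Independent S × length S ≡ rank R
rank-attained R with maxIndependent-attained (sublists (map toList R))
... | inj₁ rank≡0 = [] , []∈sublists R , tt , sym rank≡0
... | inj₂ (S′ , S′∈ , ind , len) rewrite sublists-map toList R with ∈-map⁻ (map toList) S′∈
...   | S , S∈R , refl = S , S∈R , independent⇒Independent S ind , trans (sym (ListP.length-map toList S)) len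

rank-≥1 : {R : List (Vec Bool k)} {r : Vec Bool k} → r ∈ R → r ≢ 𝟘 → 1 ≤ rank R
rank-≥1 {R = R} r∈R r≢𝟘 = rank-≥ R ([-]∈sublists r∈R) (r≢𝟘 , tt)

rank-≤-span : (R R′ : List (Vec Bool k)) → All (Span R′) R → rank R ≤ rank R′
rank-≤-span R R′ R⊆R′ with rank-attained R | basis R′
... | S , S∈R , indS , lenS | B , B∈R′ , indB , B-spans =
  subst (_≤ rank R′) lenS
    (≤-trans (independent-length-≤ _ S B refl indS
                (All-sublist R S∈R (All.map (span-trans R′ B-spans) R⊆R′)))
             (rank-≥ R′ B∈R′ indB))

Additive : (Vec Bool m → Vec Bool k) → Set
Additive T = ∀ x y → T (x ⊕ y) ≡ T x ⊕ T y

additive-𝟘 : {T : Vec Bool m → Vec Bool k} → Additive T → T 𝟘 ≡ 𝟘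
additive-𝟘 {T = T} T-add = begin
  T 𝟘           ≡⟨ cong T (⊕-self 𝟘) ⟨
  T (𝟘 ⊕ 𝟘)     ≡⟨ T-add 𝟘 𝟘 ⟩
  T 𝟘 ⊕ T 𝟘     ≡⟨ ⊕-self (T 𝟘) ⟩
  𝟘             ∎
  where open ≡-Reasoning

span-additive : {T : Vec Bool m → Vec Bool k} → Additive T →
                (S : List (Vec Bool m)) {y : Vec Bool m} → Span S y → Span (map T S) (T y)
span-additive T-add []      refl     = additive-𝟘 T-add
span-additive T-add (s ∷ S) (inj₁ p) = inj₁ (span-additive T-add S p)
span-additive T-add (s ∷ S) {y} (inj₂ p) = inj₂ (span-resp (T-add s y) (span-additive T-add S p))

independent-additive⁻ : {T : Vec Bool m → Vec Bool k} → Additive T →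
                        (S : List (Vec Bool m)) → Independent (map T S) → Independent S
independent-additive⁻ T-add []      _              = tt
independent-additive⁻ T-add (s ∷ S) (Ts∉TS , indTS) =
  Ts∉TS ∘ span-additive T-add S , independent-additive⁻ T-add S indTS

rank-additive-≤ : {T : Vec Bool m → Vec Bool k} → Additive T →
                  (R : List (Vec Bool m)) → rank (map T R) ≤ rank R
rank-additive-≤ {T = T} T-add R with rank-attained (map T R)
... | S′ , S′∈ , indS′ , len rewrite sublists-map T R with ∈-map⁻ (map T) S′∈
...   | S , S∈R , refl =
  subst (_≤ rank R) (trans (sym (ListP.length-map T S)) len)
        (rank-≥ R S∈R (independent-additive⁻ T-add S indS′))

-- Cut-rank as the rank of a cut matrix

_≈_ : Graph n → Graph n → Set
G ≈ H = ∀ i j → adj G i j ≡ adj H i j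

-- `select P` unfolds to `selectFrom P (allFin n)`.
private
  selectFrom : (Fin n → Bool) → List (Fin n) → List (Fin n)
  selectFrom P = List.foldr (λ i acc → if P i then i ∷ acc else acc) []

  ∈-selectFrom⁻ : (P : Fin n → Bool) (L : List (Fin n)) {x : Fin n} → x ∈ selectFrom P L → P x ≡ true
  ∈-selectFrom⁻ P (i ∷ L) x∈ with P i in Pi | x∈
  ... | true  | here refl  = Pi
  ... | true  | there x∈L  = ∈-selectFrom⁻ P L x∈L
  ... | false | x∈L        = ∈-selectFrom⁻ P L x∈L

  ∈-selectFrom⁺ : (P : Fin n → Bool) (L : List (Fin n)) {x : Fin n} → x ∈ L → P x ≡ true → x ∈ selectFrom P L
  ∈-selectFrom⁺ P (i ∷ L) (here refl) Px rewrite Px = here refl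
  ∈-selectFrom⁺ P (i ∷ L) (there x∈L) Px with P i
  ... | true  = there (∈-selectFrom⁺ P L x∈L Px)
  ... | false = ∈-selectFrom⁺ P L x∈L Px

  selectFrom-none : (P : Fin n → Bool) (L : List (Fin n)) → (∀ x → P x ≡ false) → selectFrom P L ≡ []
  selectFrom-none P []      _    = refl
  selectFrom-none P (i ∷ L) none rewrite none i = selectFrom-none P L none

∈-select⁻ : (P : Fin n → Bool) {x : Fin n} → x ∈ select P → P x ≡ true
∈-select⁻ {n} P = ∈-selectFrom⁻ P (allFin n)

∈-select⁺ : (P : Fin n → Bool) {x : Fin n} → P x ≡ true → x ∈ select P
∈-select⁺ {n} P {x} = ∈-selectFrom⁺ P (allFin n) (∈-allFin x)

select-none : (P : Fin n → Bool) → (∀ x → P x ≡ false) → select P ≡ []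
select-none {n} P = selectFrom-none P (allFin n)

rowsOf : Subset n → List (Fin n)
rowsOf X = select (isIn X)

colsOf : Subset n → List (Fin n)
colsOf X = select (λ i → not (isIn X i))

row∉col : (X : Subset n) {x y : Fin n} → x ∈ rowsOf X → y ∈ colsOf X → x ≢ y
row∉col X {x} x∈ y∈ refl with isIn X x | ∈-select⁻ (isIn X) x∈ | ∈-select⁻ (λ i → not (isIn X i)) y∈
... | true | _ | ()

row : Adj n → (cs : List (Fin n)) → Fin n → Vec Bool (length cs)
row A cs x = Vec.map (A x) (fromList cs)

cutMatrix : Graph n → (X : Subset n) → List (Vec Bool (length (colsOf X)))
cutMatrix G X = map (row (adj G) (colsOf X)) (rowsOf X)

cutRank≡rank : (G : Graph n) (X : Subset n) → cutRank G X ≡ rank (cutMatrix G X)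
cutRank≡rank G X = cong (rank2 (length (colsOf X))) (begin
  map (λ x → map (adj G x) (colsOf X)) (rowsOf X)
    ≡⟨ ListP.map-cong toList-row (rowsOf X) ⟩
  map (toList ∘ row (adj G) (colsOf X)) (rowsOf X)
    ≡⟨ ListP.map-∘ (rowsOf X) ⟩
  map toList (cutMatrix G X) ∎)
  where
  open ≡-Reasoning
  toList-row : ∀ x → map (adj G x) (colsOf X) ≡ toList (row (adj G) (colsOf X) x)
  toList-row x = sym (trans (VecP.toList-map (adj G x) (fromList (colsOf X)))
                            (cong (map (adj G x)) (VecP.toList∘fromList (colsOf X))))

cutRank-cong : (G H : Graph n) → G ≈ H → ∀ X → cutRank G X ≡ cutRank H X
cutRank-cong G H G≈H X = cong (rank2 (length (colsOf X)))
  (ListP.map-cong (λ x → ListP.map-cong (G≈H x) (colsOf X)) (rowsOf X))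

-- The entry in column y of a vector indexed by the columns cs; false if y ∉ cs.
entry : (cs : List (Fin n)) → Vec Bool (length cs) → Fin n → Bool
entry []       []      y = false
entry (c ∷ cs) (b ∷ w) y = if does (c ≟ y) then b else entry cs w y

entry-⊕ : (cs : List (Fin n)) (v w : Vec Bool (length cs)) (y : Fin n) →
          entry cs (v ⊕ w) y ≡ entry cs v y xor entry cs w y
entry-⊕ []       []      []      y = refl
entry-⊕ (c ∷ cs) (a ∷ v) (b ∷ w) y with does (c ≟ y)
... | true  = refl
... | false = entry-⊕ cs v w y

entry-𝟘 : (cs : List (Fin n)) (y : Fin n) → entry cs 𝟘 y ≡ false
entry-𝟘 []       y = refl
entry-𝟘 (c ∷ cs) y with does (c ≟ y)
... | true  = refl
... | false = entry-𝟘 cs y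

entry-row : (A : Adj n) (cs : List (Fin n)) {x y : Fin n} → y ∈ cs → entry cs (row A cs x) y ≡ A x y
entry-row A (c ∷ cs) {y = y} y∈ with c ≟ y | y∈
... | yes refl | _          = refl
... | no  c≢y  | here refl  = ⊥-elim (c≢y refl)
... | no  _    | there y∈cs = entry-row A cs y∈cs

map-fromList-cong : {A : Set} (cs : List (Fin n)) {f g : Fin n → A} →
                    (∀ {y} → y ∈ cs → f y ≡ g y) → Vec.map f (fromList cs) ≡ Vec.map g (fromList cs)
map-fromList-cong []       _   = refl
map-fromList-cong (c ∷ cs) f≗g = cong₂ _∷_ (f≗g (here refl)) (map-fromList-cong cs (f≗g ∘ there))

liftAdj : Adj n → Maybe (Fin n) → Maybe (Fin n) → Bool
liftAdj A (just x) (just y) = A x y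
liftAdj A _        _        = false

-- Every row of the cut matrix of H at Y is the image, under one additive map,
-- of a vector in the row space of the cut matrix of G at X; vertices outside
-- the domain of φ are isolated in H.
cutRank-pullback-≤ : (G : Graph n) (H : Graph m) (φ : Fin m → Maybe (Fin n))
                     (X : Subset n) (Y : Subset m) →
                     (∀ {y y′} → φ y ≡ just y′ → isIn Y y ≡ isIn X y′) →
                     (∀ x y → adj H x y ≡ liftAdj (adj G) (φ x) (φ y)) →
                     cutRank H Y ≤ cutRank G X
cutRank-pullback-≤ {n} G H φ X Y sides pulls rewrite cutRank≡rank H Y | cutRank≡rank G X =
  subst (λ M → rank M ≤ rank (cutMatrix G X)) (sym matrix≡)
    (≤-trans (rank-additive-≤ Q-additive R) (rank-≤-span R (cutMatrix G X) R-in-span))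
  where
  csX = colsOf X
  csY = colsOf Y
  r : Maybe (Fin n) → Vec Bool (length csX)
  r (just x) = row (adj G) csX x
  r nothing  = 𝟘
  e : Vec Bool (length csX) → Maybe (Fin n) → Bool
  e w (just y) = entry csX w y
  e w nothing  = false
  Q : Vec Bool (length csX) → Vec Bool (length csY)
  Q w = Vec.map (e w ∘ φ) (fromList csY)
  Q-additive : Additive Q
  Q-additive v w = trans (map-fromList-cong csY (λ {y} _ → e-⊕ (φ y))) (map-xor _ _ (fromList csY))
    where
    e-⊕ : ∀ y → e (v ⊕ w) y ≡ e v y xor e w y
    e-⊕ (just y) = entry-⊕ csX v w y
    e-⊕ nothing  = refl
  R = map (r ∘ φ) (rowsOf Y)
  entry≡ : ∀ x {y} → y ∈ csY → liftAdj (adj G) (φ x) (φ y) ≡ e (r (φ x)) (φ y)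
  entry≡ x {y} y∈ with φ x | φ y in φy
  ... | just x′ | just y′ = sym (entry-row (adj G) csX
          (∈-select⁺ (λ i → not (isIn X i)) (trans (cong not (sym (sides φy))) (∈-select⁻ _ y∈))))
  ... | just x′ | nothing = refl
  ... | nothing | just y′ = sym (entry-𝟘 csX y′)
  ... | nothing | nothing = refl
  matrix≡ : cutMatrix H Y ≡ map Q R
  matrix≡ = trans (ListP.map-cong-local (All.tabulate λ {x} _ →
                     map-fromList-cong csY λ {y} y∈ → trans (pulls x y) (entry≡ x y∈)))
                  (ListP.map-∘ (rowsOf Y))
  R-in-span : All (Span (cutMatrix G X)) R
  R-in-span = AllP.map⁺ (All.tabulate λ {x} x∈ → in-span (φ x) refl (∈-select⁻ (isIn Y) x∈))
    where
    in-span : ∀ {x} m → φ x ≡ m → isIn Y x ≡ true → Span (cutMatrix G X) (r m)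
    in-span (just x′) φx inY = span-∈ (∈-map⁺ (row (adj G) csX) (∈-select⁺ (isIn X) (trans (sym (sides φx)) inY)))
    in-span nothing   _  _   = span-𝟘 (cutMatrix G X)

-- Local complementation

localComp-diag : (A : Adj n) (v i : Fin n) → localComp A v i i ≡ A i i
localComp-diag A v i with i ≟ i
... | yes _   = refl
... | no  i≢i = ⊥-elim (i≢i refl)

localComp-off : (A : Adj n) (v : Fin n) {i j : Fin n} → i ≢ j →
                localComp A v i j ≡ A i j xor (A v i ∧ A v j)
localComp-off A v {i} {j} i≢j with i ≟ j
... | yes i≡j = ⊥-elim (i≢j i≡j)
... | no  _   = refl

localCompGraph : Graph n → Fin n → Graph n
localCompGraph G v = record
  { adj    = localComp (adj G) v
  ; sym    = symmetric
  ; irrefl = λ i → trans (localComp-diag (adj G) v i) (irrefl G i)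
  }
  where
  symmetric : ∀ i j → localComp (adj G) v i j ≡ localComp (adj G) v j i
  symmetric i j with i ≟ j
  ... | yes refl = sym (localComp-diag (adj G) v i)
  ... | no  i≢j  = trans (cong₂ _xor_ (Graph.sym G i j) (∧-comm (adj G v i) (adj G v j)))
                         (sym (localComp-off (adj G) v (i≢j ∘ sym)))

localComps : Graph n → List (Fin n) → Graph n
localComps G []       = G
localComps G (v ∷ vs) = localCompGraph (localComps G vs) v

locallyEquiv⇒localComps : (G : Graph n) {B : Adj n} → LocallyEquiv (adj G) B →
                          ∃[ vs ] B ≡ adj (localComps G vs)
locallyEquiv⇒localComps G le-refl         = [] , refl
locallyEquiv⇒localComps G (le-step G~B v) with locallyEquiv⇒localComps G G~B
... | vs , refl = v ∷ vs , refl

localComps⇒locallyEquiv : (G : Graph n) (vs : List (Fin n)) → LocallyEquiv (adj G) (adj (localComps G vs))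
localComps⇒locallyEquiv G []       = le-refl
localComps⇒locallyEquiv G (v ∷ vs) = le-step (localComps⇒locallyEquiv G vs) v

row-localComp : (G : Graph n) (v : Fin n) (X : Subset n) {x : Fin n} → x ∈ rowsOf X →
                row (localComp (adj G) v) (colsOf X) x ≡
                row (adj G) (colsOf X) x ⊕ adj G v x · row (adj G) (colsOf X) v
row-localComp G v X {x} x∈ =
  trans (map-fromList-cong (colsOf X) (λ y∈ → localComp-off (adj G) v (row∉col X x∈ y∈)))
        (added (adj G v x))
  where
  cs = fromList (colsOf X)
  added : ∀ b → Vec.map (λ y → adj G x y xor (b ∧ adj G v y)) cs ≡
                row (adj G) (colsOf X) x ⊕ b · row (adj G) (colsOf X) v
  added true  = map-xor (adj G x) (adj G v) cs
  added false = trans (VecP.map-cong (xor-identityʳ ∘ adj G x) cs) (sym (⊕-identityʳ _))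

cutMatrix-localComp : (G : Graph n) (v : Fin n) (X : Subset n) →
  cutMatrix (localCompGraph G v) X ≡
  map (λ x → row (adj G) (colsOf X) x ⊕ adj G v x · row (adj G) (colsOf X) v) (rowsOf X)
cutMatrix-localComp G v X = ListP.map-cong-local (All.tabulate (row-localComp G v X))

rank-localComp-inside : (G : Graph n) (v : Fin n) (X : Subset n) → isIn X v ≡ true →
                        rank (cutMatrix (localCompGraph G v) X) ≤ rank (cutMatrix G X)
rank-localComp-inside G v X v∈X =
  subst (λ M → rank M ≤ rank (cutMatrix G X)) (sym (cutMatrix-localComp G v X))
    (rank-≤-span _ (cutMatrix G X) (AllP.map⁺ (All.tabulate λ {x} x∈ →
       span-⊕ (cutMatrix G X) (span-∈ (∈-map⁺ r x∈))
              (span-· (cutMatrix G X) (adj G v x) (span-∈ (∈-map⁺ r (∈-select⁺ (isIn X) v∈X)))))))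
  where r = row (adj G) (colsOf X)

rank-localComp-outside : (G : Graph n) (v : Fin n) (X : Subset n) → isIn X v ≡ false →
                         rank (cutMatrix (localCompGraph G v) X) ≤ rank (cutMatrix G X)
rank-localComp-outside G v X v∉X =
  subst (λ M → rank M ≤ rank (cutMatrix G X)) (sym matrix≡) (rank-additive-≤ T-additive (cutMatrix G X))
  where
  cs = colsOf X
  r = row (adj G) cs
  v∈cs : v ∈ cs
  v∈cs = ∈-select⁺ (λ i → not (isIn X i)) (cong not v∉X)
  -- Column v of the cut matrix records which rows get row v added.
  T : Vec Bool (length cs) → Vec Bool (length cs)
  T w = w ⊕ entry cs w v · r v
  T-additive : Additive T
  T-additive w₁ w₂ = begin
    (w₁ ⊕ w₂) ⊕ entry cs (w₁ ⊕ w₂) v · r v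
      ≡⟨ cong (λ b → (w₁ ⊕ w₂) ⊕ b · r v) (entry-⊕ cs w₁ w₂ v) ⟩
    (w₁ ⊕ w₂) ⊕ (entry cs w₁ v xor entry cs w₂ v) · r v
      ≡⟨ cong ((w₁ ⊕ w₂) ⊕_) (·-xor (entry cs w₁ v) (entry cs w₂ v) (r v)) ⟩
    (w₁ ⊕ w₂) ⊕ (entry cs w₁ v · r v ⊕ entry cs w₂ v · r v)
      ≡⟨ ⊕-interchange w₁ w₂ (entry cs w₁ v · r v) (entry cs w₂ v · r v) ⟩
    T w₁ ⊕ T w₂ ∎
    where open ≡-Reasoning
  matrix≡ : cutMatrix (localCompGraph G v) X ≡ map T (cutMatrix G X)
  matrix≡ = trans (cutMatrix-localComp G v X)
    (trans (ListP.map-cong (λ x → cong (λ b → r x ⊕ b · r v)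
                                     (trans (Graph.sym G v x) (sym (entry-row (adj G) cs v∈cs)))) (rowsOf X))
           (ListP.map-∘ (rowsOf X)))

cutRank-localComp-≤ : (G : Graph n) (v : Fin n) (X : Subset n) →
                      cutRank (localCompGraph G v) X ≤ cutRank G X
cutRank-localComp-≤ G v X rewrite cutRank≡rank (localCompGraph G v) X | cutRank≡rank G X
  with isIn X v in v∈X
... | true  = rank-localComp-inside G v X v∈X
... | false = rank-localComp-outside G v X v∈X

cutRank-localComps-≤ : (G : Graph n) (vs : List (Fin n)) (X : Subset n) →
                       cutRank (localComps G vs) X ≤ cutRank G X
cutRank-localComps-≤ G []       X = ≤-refl
cutRank-localComps-≤ G (v ∷ vs) X =
  ≤-trans (cutRank-localComp-≤ (localComps G vs) v X) (cutRank-localComps-≤ G vs X)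

localComp-outside : (A : Adj n) {x i : Fin n} → A x i ≡ false → ∀ j → localComp A x i j ≡ A i j
localComp-outside A {x} {i} xi j with i ≟ j
... | yes _ = refl
... | no  _ rewrite xi = xor-identityʳ (A i j)

localComp-outsideʳ : (A : Adj n) {x j : Fin n} → A x j ≡ false → ∀ i → localComp A x i j ≡ A i j
localComp-outsideʳ A {x} {j} xj i with i ≟ j
... | yes _ = refl
... | no  _ rewrite xj | ∧-zeroʳ (A x i) = xor-identityʳ (A i j)

localComp-cong : {A B : Adj n} → (∀ i j → A i j ≡ B i j) → ∀ v i j → localComp A v i j ≡ localComp B v i j
localComp-cong A≈B v i j rewrite A≈B i j | A≈B v i | A≈B v j = refl

localComps-cong : {G H : Graph n} → G ≈ H → ∀ vs → localComps G vs ≈ localComps H vs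
localComps-cong G≈H []       = G≈H
localComps-cong G≈H (v ∷ vs) = localComp-cong (localComps-cong G≈H vs) v

localComps-++ : (G : Graph n) (us vs : List (Fin n)) → localComps G (us ++ vs) ≡ localComps (localComps G vs) us
localComps-++ G []       vs = refl
localComps-++ G (u ∷ us) vs = cong (λ H → localCompGraph H u) (localComps-++ G us vs)

localComp-involutive : (G : Graph n) (v : Fin n) → localCompGraph (localCompGraph G v) v ≈ G
localComp-involutive G v i j with i ≟ j
... | yes _ = refl
... | no  _ rewrite localComp-outside (adj G) {v} {v} (irrefl G v) i
                  | localComp-outside (adj G) {v} {v} (irrefl G v) j
  = trans (xor-assoc (adj G i j) c c) (trans (cong (adj G i j xor_) (xor-same c)) (xor-identityʳ (adj G i j)))
  where c = adj G v i ∧ adj G v j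

-- Sums over all subsets

sumSubsets : (n : ℕ) → (Subset n → ℕ) → ℕ
sumSubsets n F = sum (map F (allSubsets n))

private
  sum-map-+ : {A : Set} (F G : A → ℕ) (L : List A) →
              sum (map (λ X → F X + G X) L) ≡ sum (map F L) + sum (map G L)
  sum-map-+ F G []      = refl
  sum-map-+ F G (X ∷ L) rewrite sum-map-+ F G L = interchange (F X) (G X) _ _
    where
    interchange : ∀ a b c d → (a + b) + (c + d) ≡ (a + c) + (b + d)
    interchange = solve-∀

  sum-map-mono : {A : Set} (F G : A → ℕ) (L : List A) → (∀ X → F X ≤ G X) → sum (map F L) ≤ sum (map G L)
  sum-map-mono F G []      _   = z≤n
  sum-map-mono F G (X ∷ L) F≤G = +-mono-≤ (F≤G X) (sum-map-mono F G L F≤G)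

  split-sum : (F : Subset (suc n) → ℕ) (L : List (Subset n)) →
              sum (map F (List.concatMap (λ p → (outside ∷ p) ∷ (inside ∷ p) ∷ []) L)) ≡
              sum (map (λ p → F (outside ∷ p) + F (inside ∷ p)) L)
  split-sum F []      = refl
  split-sum F (p ∷ L) rewrite split-sum F L = sym (+-assoc (F (outside ∷ p)) (F (inside ∷ p)) _)

sumSubsets-suc : (F : Subset (suc n) → ℕ) →
                 sumSubsets (suc n) F ≡ sumSubsets n (λ X → F (outside ∷ X) + F (inside ∷ X))
sumSubsets-suc {n} F = split-sum F (allSubsets n)

sumSubsets-+ : (F G : Subset n → ℕ) → sumSubsets n (λ X → F X + G X) ≡ sumSubsets n F + sumSubsets n G
sumSubsets-+ {n} F G = sum-map-+ F G (allSubsets n)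

sumSubsets-cong : {F G : Subset n → ℕ} → (∀ X → F X ≡ G X) → sumSubsets n F ≡ sumSubsets n G
sumSubsets-cong {n} F≗G = cong sum (ListP.map-cong F≗G (allSubsets n))

sumSubsets-mono : {F G : Subset n → ℕ} → (∀ X → F X ≤ G X) → sumSubsets n F ≤ sumSubsets n G
sumSubsets-mono {n} {F} {G} = sum-map-mono F G (allSubsets n)

sumSubsets-mono-< : {F G : Subset n → ℕ} → (∀ X → F X ≤ G X) → ∀ X₀ → F X₀ ℕ.< G X₀ →
                    sumSubsets n F ℕ.< sumSubsets n G
sumSubsets-mono-< {zero}          F≤G []       F<G = +-mono-<-≤ F<G z≤n
sumSubsets-mono-< {suc n} {F} {G} F≤G (b ∷ X₀) F<G
  rewrite sumSubsets-suc F | sumSubsets-suc G =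
  sumSubsets-mono-< (λ X → +-mono-≤ (F≤G (outside ∷ X)) (F≤G (inside ∷ X))) X₀ (both b F<G)
  where
  both : ∀ b → F (b ∷ X₀) ℕ.< G (b ∷ X₀) →
         F (outside ∷ X₀) + F (inside ∷ X₀) ℕ.< G (outside ∷ X₀) + G (inside ∷ X₀)
  both false F<G = +-mono-<-≤ F<G (F≤G _)
  both true  F<G = +-mono-≤-< (F≤G _) F<G

sumSubsets-insertAt : (j : Fin (suc m)) (F : Subset (suc m) → ℕ) →
  sumSubsets m (λ Y → F (insertAt Y j outside) + F (insertAt Y j inside)) ≡ sumSubsets (suc m) F
sumSubsets-insertAt {m}     zero    F = sym (sumSubsets-suc F)
sumSubsets-insertAt {suc m} (suc j) F = begin
  sumSubsets (suc m) (λ Y → F (insertAt Y (suc j) outside) + F (insertAt Y (suc j) inside))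
    ≡⟨ sumSubsets-suc (λ Y → F (insertAt Y (suc j) outside) + F (insertAt Y (suc j) inside)) ⟩
  sumSubsets m (λ Y → (F₀ (insertAt Y j outside) + F₀ (insertAt Y j inside)) +
                      (F₁ (insertAt Y j outside) + F₁ (insertAt Y j inside)))
    ≡⟨ sumSubsets-+ (λ Y → F₀ (insertAt Y j outside) + F₀ (insertAt Y j inside))
                    (λ Y → F₁ (insertAt Y j outside) + F₁ (insertAt Y j inside)) ⟩
  sumSubsets m (λ Y → F₀ (insertAt Y j outside) + F₀ (insertAt Y j inside)) +
  sumSubsets m (λ Y → F₁ (insertAt Y j outside) + F₁ (insertAt Y j inside))
    ≡⟨ cong₂ _+_ (sumSubsets-insertAt j F₀) (sumSubsets-insertAt j F₁) ⟩
  sumSubsets (suc m) F₀ + sumSubsets (suc m) F₁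
    ≡⟨ sumSubsets-+ F₀ F₁ ⟨
  sumSubsets (suc m) (λ Y → F₀ Y + F₁ Y)
    ≡⟨ sumSubsets-suc F ⟨
  sumSubsets (suc (suc m)) F ∎
  where
  open ≡-Reasoning
  F₀ F₁ : Subset (suc m) → ℕ
  F₀ Y = F (outside ∷ Y)
  F₁ Y = F (inside ∷ Y)

preimage : (Fin m → Fin n) → Subset n → Subset m
preimage f X = tabulate (lookup X ∘ f)

private
  *-double : ∀ x y p q → x * p ≡ y * q → x * (2 * p) ≡ y * (2 * q)
  *-double x y p q eq = begin
    x * (2 * p)   ≡⟨ double x p ⟩
    x * p + x * p ≡⟨ cong₂ _+_ eq eq ⟩
    y * q + y * q ≡⟨ double y q ⟨
    y * (2 * q)   ∎
    where
    open ≡-Reasoning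
    double : ∀ x p → x * (2 * p) ≡ x * p + x * p
    double = solve-∀

  +-self-* : ∀ x p → (x + x) * p ≡ x * (2 * p)
  +-self-* = solve-∀

-- Each subset of the m vertices in the image of f has 2 ^ (n - m) preimages
-- under X ↦ preimage f X; this is stated without subtraction.
sumSubsets-preimage : ∀ n {m} (f : Fin m → Fin n) → Injective _≡_ _≡_ f → (F : Subset m → ℕ) →
                      sumSubsets n (F ∘ preimage f) * 2 ^ m ≡ sumSubsets m F * 2 ^ n
sumSubsets-preimage zero    {zero}  f _     F = refl
sumSubsets-preimage zero    {suc m} f _     F with () ← f zero
sumSubsets-preimage (suc n) {m}     f f-inj F with any? (λ j → f j ≟ zero)
... | yes (j , fj≡0) = hit f f-inj F j fj≡0
  where
  hit : ∀ {m} (f : Fin m → Fin (suc n)) → Injective _≡_ _≡_ f → (F : Subset m → ℕ) → ∀ j → f j ≡ zero →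
        sumSubsets (suc n) (F ∘ preimage f) * 2 ^ m ≡ sumSubsets m F * 2 ^ suc n
  hit {suc m} f f-inj F j fj≡0 = begin
    sumSubsets (suc n) (F ∘ preimage f) * 2 ^ suc m
      ≡⟨ cong (_* 2 ^ suc m) (trans (sumSubsets-suc (F ∘ preimage f)) (sumSubsets-cong λ p →
           cong₂ _+_ (cong F (preimage-∷ outside p)) (cong F (preimage-∷ inside p)))) ⟩
    sumSubsets n (Fⱼ ∘ preimage f′) * (2 * 2 ^ m)
      ≡⟨ *-double (sumSubsets n (Fⱼ ∘ preimage f′)) (sumSubsets m Fⱼ) (2 ^ m) (2 ^ n)
                  (sumSubsets-preimage n f′ f′-inj Fⱼ) ⟩
    sumSubsets m Fⱼ * (2 * 2 ^ n)
      ≡⟨ cong (_* (2 * 2 ^ n)) (sumSubsets-insertAt j F) ⟩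
    sumSubsets (suc m) F * 2 ^ suc n ∎
    where
    open ≡-Reasoning
    Fⱼ : Subset m → ℕ
    Fⱼ Y = F (insertAt Y j outside) + F (insertAt Y j inside)
    0≢f : ∀ k → zero ≢ f (punchIn j k)
    0≢f k eq = punchInᵢ≢i j k (f-inj (trans (sym eq) (sym fj≡0)))
    f′ : Fin m → Fin n
    f′ k = punchOut (0≢f k)
    f′-inj : Injective _≡_ _≡_ f′
    f′-inj {k} {l} eq = punchIn-injective j k l (f-inj (punchOut-injective (0≢f k) (0≢f l) eq))
    preimage-∷ : ∀ b p → preimage f (b ∷ p) ≡ insertAt (preimage f′ p) j b
    preimage-∷ b p = trans (VecP.tabulate-cong entries) (VecP.tabulate∘lookup (insertAt (preimage f′ p) j b))
      where
      entries : ∀ i → lookup (b ∷ p) (f i) ≡ lookup (insertAt (preimage f′ p) j b) i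
      entries i with j ≟ i
      ... | yes refl = trans (cong (lookup (b ∷ p)) fj≡0) (sym (VecP.insertAt-lookup (preimage f′ p) j b))
      ... | no  j≢i  = begin
        lookup (b ∷ p) (f i)                           ≡⟨ cong (lookup (b ∷ p) ∘ f) (sym i≡) ⟩
        lookup (b ∷ p) (f (punchIn j i′))               ≡⟨ cong (lookup (b ∷ p)) (sym (punchIn-punchOut (0≢f i′))) ⟩
        lookup p (f′ i′)                                ≡⟨ VecP.lookup∘tabulate (lookup p ∘ f′) i′ ⟨
        lookup (preimage f′ p) i′                       ≡⟨ VecP.insertAt-punchIn (preimage f′ p) j b i′ ⟨
        lookup (insertAt (preimage f′ p) j b) (punchIn j i′) ≡⟨ cong (lookup (insertAt (preimage f′ p) j b)) i≡ ⟩
        lookup (insertAt (preimage f′ p) j b) i        ∎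
        where
        i′ = punchOut j≢i
        i≡ : punchIn j i′ ≡ i
        i≡ = punchIn-punchOut j≢i
... | no  0∉f = begin
  sumSubsets (suc n) (F ∘ preimage f) * 2 ^ m
    ≡⟨ cong (_* 2 ^ m) (trans (sumSubsets-suc (F ∘ preimage f)) (sumSubsets-cong λ p →
         cong₂ _+_ (cong F (preimage-∷ outside p)) (cong F (preimage-∷ inside p)))) ⟩
  sumSubsets n (λ p → F (preimage f′ p) + F (preimage f′ p)) * 2 ^ m
    ≡⟨ cong (_* 2 ^ m) (sumSubsets-+ {n} (F ∘ preimage f′) (F ∘ preimage f′)) ⟩
  (sumSubsets n (F ∘ preimage f′) + sumSubsets n (F ∘ preimage f′)) * 2 ^ m
    ≡⟨ +-self-* (sumSubsets n (F ∘ preimage f′)) (2 ^ m) ⟩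
  sumSubsets n (F ∘ preimage f′) * (2 * 2 ^ m)
    ≡⟨ *-double (sumSubsets n (F ∘ preimage f′)) (sumSubsets m F) (2 ^ m) (2 ^ n)
                (sumSubsets-preimage n f′ f′-inj F) ⟩
  sumSubsets m F * 2 ^ suc n ∎
  where
  open ≡-Reasoning
  0≢f : ∀ j → zero ≢ f j
  0≢f j eq = 0∉f (j , sym eq)
  f′ : Fin m → Fin n
  f′ j = punchOut (0≢f j)
  f′-inj : Injective _≡_ _≡_ f′
  f′-inj {k} {l} eq = f-inj (punchOut-injective (0≢f k) (0≢f l) eq)
  preimage-∷ : ∀ b p → preimage f (b ∷ p) ≡ preimage f′ p
  preimage-∷ b p = VecP.tabulate-cong λ i → cong (lookup (b ∷ p)) (sym (punchIn-punchOut (0≢f i)))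

-- Induced subgraphs and average cut-rank

induced : Graph n → (Fin m → Fin n) → Graph m
induced G f = record
  { adj    = λ i j → adj G (f i) (f j)
  ; sym    = λ i j → Graph.sym G (f i) (f j)
  ; irrefl = irrefl G ∘ f
  }

_─_ : Graph (suc n) → Fin (suc n) → Graph n
G ─ v = induced G (punchIn v)

Isolated : Graph n → Fin n → Set
Isolated G v = ∀ w → adj G v w ≡ false

isIn-lookup : (X : Subset n) (i : Fin n) → isIn X i ≡ lookup X i
isIn-lookup X i with lookup X i
... | true  = refl
... | false = refl

isIn-preimage : (f : Fin m → Fin n) (X : Subset n) (i : Fin m) → isIn (preimage f X) i ≡ isIn X (f i)
isIn-preimage f X i = trans (isIn-lookup (preimage f X) i)
                            (trans (VecP.lookup∘tabulate (lookup X ∘ f) i) (sym (isIn-lookup X (f i))))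

cutRank-induced-≤ : (G : Graph n) (f : Fin m → Fin n) (X : Subset n) →
                    cutRank (induced G f) (preimage f X) ≤ cutRank G X
cutRank-induced-≤ G f X =
  cutRank-pullback-≤ G (induced G f) (just ∘ f) X (preimage f X)
    (λ { {y} refl → isIn-preimage f X y }) (λ _ _ → refl)

punchOut? : Fin (suc n) → Fin (suc n) → Maybe (Fin n)
punchOut? u x with u ≟ x
... | yes _   = nothing
... | no  u≢x = just (punchOut u≢x)

cutRank-delete-isolated : (G : Graph (suc n)) (u : Fin (suc n)) → Isolated G u → (X : Subset (suc n)) →
                          cutRank G X ≤ cutRank (G ─ u) (preimage (punchIn u) X)
cutRank-delete-isolated G u u-isolated X =
  cutRank-pullback-≤ (G ─ u) G (punchOut? u) (preimage (punchIn u) X) X sides pulls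
  where
  sides : ∀ {x x′} → punchOut? u x ≡ just x′ → isIn X x ≡ isIn (preimage (punchIn u) X) x′
  sides {x} eq with u ≟ x | eq
  ... | no u≢x | refl = trans (cong (isIn X) (sym (punchIn-punchOut u≢x)))
                              (sym (isIn-preimage (punchIn u) X (punchOut u≢x)))
  pulls : ∀ x y → adj G x y ≡ liftAdj (adj (G ─ u)) (punchOut? u x) (punchOut? u y)
  pulls x y with u ≟ x | u ≟ y
  ... | yes refl | _        = u-isolated y
  ... | no  u≢x  | yes refl = trans (Graph.sym G x u) (u-isolated x)
  ... | no  u≢x  | no  u≢y  = sym (cong₂ (adj G) (punchIn-punchOut u≢x) (punchIn-punchOut u≢y))

cutRank-no-rows : (G : Graph n) (X : Subset n) → (∀ i → isIn X i ≡ false) → cutRank G X ≡ 0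
cutRank-no-rows G X none rewrite select-none (isIn X) none = refl

cutRank-⁅⁆-≥1 : (G : Graph n) {v w : Fin n} → adj G v w ≡ true → 1 ≤ cutRank G ⁅ v ⁆
cutRank-⁅⁆-≥1 G {v} {w} vw rewrite cutRank≡rank G ⁅ v ⁆ =
  rank-≥1 (∈-map⁺ (row (adj G) cs) (∈-select⁺ (isIn ⁅ v ⁆) v∈⁅v⁆)) row≢𝟘
  where
  cs = colsOf ⁅ v ⁆
  v∈⁅v⁆ : isIn ⁅ v ⁆ v ≡ true
  v∈⁅v⁆ = trans (isIn-lookup ⁅ v ⁆ v) (VecP.[]=⇒lookup (x∈⁅x⁆ v))
  w≢v : w ≢ v
  w≢v refl with () ← trans (sym vw) (irrefl G v)
  w∉⁅v⁆ : isIn ⁅ v ⁆ w ≡ false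
  w∉⁅v⁆ with isIn ⁅ v ⁆ w in w∈
  ... | false = refl
  ... | true  = ⊥-elim (w≢v (x∈⁅y⁆⇒x≡y v (VecP.lookup⇒[]= w ⁅ v ⁆ (trans (sym (isIn-lookup ⁅ v ⁆ w)) w∈))))
  row≢𝟘 : row (adj G) cs v ≢ 𝟘
  row≢𝟘 eq with () ← trans (sym vw) (trans (sym (entry-row (adj G) cs (∈-select⁺ _ (cong not w∉⁅v⁆))))
                                             (trans (cong (λ r → entry cs r w) eq) (entry-𝟘 cs w)))

private
  toℚᵘ-/ : ∀ a b → toℚᵘ ((+ a) / suc b) ℚᵘ.≃ ℚᵘ.mkℚᵘ (+ a) b
  toℚᵘ-/ a b = toℚᵘ-fromℚᵘ (ℚᵘ.mkℚᵘ (+ a) b)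

  pos-*-≤ : ∀ a b c d → a * d ≤ c * b → (+ a) ℤ.* (+ d) ℤ.≤ (+ c) ℤ.* (+ b)
  pos-*-≤ a b c d h rewrite sym (ℤP.pos-* a d) | sym (ℤP.pos-* c b) = ℤ.+≤+ h

  pos-*-< : ∀ a b c d → a * d ℕ.< c * b → (+ a) ℤ.* (+ d) ℤ.< (+ c) ℤ.* (+ b)
  pos-*-< a b c d h rewrite sym (ℤP.pos-* a d) | sym (ℤP.pos-* c b) = ℤ.+<+ h

fraction-≤ : ∀ a b c d .{{_ : NonZero b}} .{{_ : NonZero d}} → a * d ≤ c * b → (+ a) / b ℚ.≤ (+ c) / d
fraction-≤ a (suc b) c (suc d) h = toℚᵘ-cancel-≤
  (ℚᵘP.≤-respˡ-≃ (ℚᵘP.≃-sym (toℚᵘ-/ a b)) (ℚᵘP.≤-respʳ-≃ (ℚᵘP.≃-sym (toℚᵘ-/ c d))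
    (ℚᵘ.*≤* (pos-*-≤ a (suc b) c (suc d) h))))

fraction-< : ∀ a b c d .{{_ : NonZero b}} .{{_ : NonZero d}} → a * d ℕ.< c * b → (+ a) / b ℚ.< (+ c) / d
fraction-< a (suc b) c (suc d) h = toℚᵘ-cancel-<
  (ℚᵘP.<-respˡ-≃ (ℚᵘP.≃-sym (toℚᵘ-/ a b)) (ℚᵘP.<-respʳ-≃ (ℚᵘP.≃-sym (toℚᵘ-/ c d))
    (ℚᵘ.*<* (pos-*-< a (suc b) c (suc d) h))))

private
  dyadic-≤ : ∀ a m c n → a * 2 ^ n ≤ c * 2 ^ m →
          _/_ (+ a) (2 ^ m) {{m^n≢0 2 m}} ℚ.≤ _/_ (+ c) (2 ^ n) {{m^n≢0 2 n}}
  dyadic-≤ a m c n = fraction-≤ a (2 ^ m) c (2 ^ n) {{m^n≢0 2 m}} {{m^n≢0 2 n}}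

  dyadic-< : ∀ a m c n → a * 2 ^ n ℕ.< c * 2 ^ m →
          _/_ (+ a) (2 ^ m) {{m^n≢0 2 m}} ℚ.< _/_ (+ c) (2 ^ n) {{m^n≢0 2 n}}
  dyadic-< a m c n = fraction-< a (2 ^ m) c (2 ^ n) {{m^n≢0 2 m}} {{m^n≢0 2 n}}

avgCutRank-cong : (G H : Graph n) → G ≈ H → avgCutRank G ≡ avgCutRank H
avgCutRank-cong {n} G H G≈H =
  cong (λ s → _/_ (+ s) (2 ^ n) {{m^n≢0 2 n}}) (sumSubsets-cong (cutRank-cong G H G≈H))

avgCutRank-mono : (G H : Graph n) → (∀ X → cutRank G X ≤ cutRank H X) → avgCutRank G ℚ.≤ avgCutRank H
avgCutRank-mono {n} G H G≤H =
  dyadic-≤ (sumSubsets n (cutRank G)) n (sumSubsets n (cutRank H)) n (*-monoˡ-≤ (2 ^ n) (sumSubsets-mono G≤H))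

avgCutRank-localComps-≤ : (G : Graph n) (vs : List (Fin n)) → avgCutRank (localComps G vs) ℚ.≤ avgCutRank G
avgCutRank-localComps-≤ G vs = avgCutRank-mono (localComps G vs) G (cutRank-localComps-≤ G vs)

avgCutRank-induced-≤ : (G : Graph n) (f : Fin m → Fin n) → Injective _≡_ _≡_ f →
                       avgCutRank (induced G f) ℚ.≤ avgCutRank G
avgCutRank-induced-≤ {n} {m} G f f-inj =
  dyadic-≤ (sumSubsets m (cutRank (induced G f))) m (sumSubsets n (cutRank G)) n
  (subst (_≤ sumSubsets n (cutRank G) * 2 ^ m) (sumSubsets-preimage n f f-inj (cutRank (induced G f)))
    (*-monoˡ-≤ (2 ^ m) (sumSubsets-mono (cutRank-induced-≤ G f))))

avgCutRank-induced-< : (G : Graph n) (f : Fin m → Fin n) → Injective _≡_ _≡_ f →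
                       {v w : Fin n} → (∀ i → f i ≢ v) → adj G v w ≡ true →
                       avgCutRank (induced G f) ℚ.< avgCutRank G
avgCutRank-induced-< {n} {m} G f f-inj {v} v∉f vw =
  dyadic-< (sumSubsets m (cutRank (induced G f))) m (sumSubsets n (cutRank G)) n
  (subst (ℕ._< sumSubsets n (cutRank G) * 2 ^ m) (sumSubsets-preimage n f f-inj (cutRank (induced G f)))
    (*-monoˡ-< (2 ^ m) {{m^n≢0 2 m}} (sumSubsets-mono-< (cutRank-induced-≤ G f) ⁅ v ⁆ (begin-strict
      cutRank (induced G f) (preimage f ⁅ v ⁆) ≡⟨ cutRank-no-rows (induced G f) (preimage f ⁅ v ⁆) preimage-empty ⟩
      0                                         <⟨ cutRank-⁅⁆-≥1 G vw ⟩
      cutRank G ⁅ v ⁆                           ∎))))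
  where
  open ℕₚ.≤-Reasoning
  preimage-empty : ∀ i → isIn (preimage f ⁅ v ⁆) i ≡ false
  preimage-empty i with isIn (preimage f ⁅ v ⁆) i in fi∈
  ... | false = refl
  ... | true  = ⊥-elim (v∉f i (x∈⁅y⁆⇒x≡y v (VecP.lookup⇒[]= (f i) ⁅ v ⁆
                  (trans (sym (isIn-lookup ⁅ v ⁆ (f i))) (trans (sym (isIn-preimage f ⁅ v ⁆ i)) fi∈)))))

avgCutRank-delete-isolated : (G : Graph (suc n)) (u : Fin (suc n)) → Isolated G u →
                             avgCutRank G ℚ.≤ avgCutRank (G ─ u)
avgCutRank-delete-isolated {n} G u u-isolated =
  dyadic-≤ (sumSubsets (suc n) (cutRank G)) (suc n) (sumSubsets n (cutRank (G ─ u))) n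
  (subst (sumSubsets (suc n) (cutRank G) * 2 ^ n ≤_)
    (sumSubsets-preimage (suc n) (punchIn u) (punchIn-injective u _ _) (cutRank (G ─ u)))
    (*-monoˡ-≤ (2 ^ n) (sumSubsets-mono (cutRank-delete-isolated G u u-isolated))))

noIsolated⊎isolated : (G : Graph n) → NoIsolated G ⊎ ∃[ v ] Isolated G v
noIsolated⊎isolated G with any? (λ v → all? (λ w → adj G v w Bool.≟ false))
... | yes v-isolated = inj₂ v-isolated
... | no  none       = inj₁ λ v → neighbour v
  where
  neighbour : ∀ v → ∃[ w ] adj G v w ≡ true
  neighbour v with any? (λ w → adj G v w Bool.≟ true)
  ... | yes found = found
  ... | no  ¬found = ⊥-elim (none (v , λ w → ¬-not (λ vw → ¬found (w , vw))))

localComp-noIsolated : (G : Graph n) (v : Fin n) → NoIsolated G → NoIsolated (localCompGraph G v)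
localComp-noIsolated G v noIso x with v ≟ x
... | yes refl = let (w , vw) = noIso v in w , trans (localComp-outside (adj G) (irrefl G v) w) vw
... | no  _    = neighbour (adj G v x) refl
  where
  neighbour : ∀ b → adj G v x ≡ b → ∃[ w ] localComp (adj G) v x w ≡ true
  neighbour true  vx = v , trans (localComp-outsideʳ (adj G) (irrefl G v) x) (trans (Graph.sym G x v) vx)
  neighbour false vx = let (w , xw) = noIso x in w , trans (localComp-outside (adj G) vx w) xw

localComps-noIsolated : (G : Graph n) (vs : List (Fin n)) → NoIsolated G → NoIsolated (localComps G vs)
localComps-noIsolated G []       noIso = noIso
localComps-noIsolated G (v ∷ vs) noIso = localComp-noIsolated (localComps G vs) v (localComps-noIsolated G vs noIso)

K₂Component : Graph n → Fin n → Fin n → Set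
K₂Component G u v = (∀ x → adj G u x ≡ does (v ≟ x)) × (∀ x → adj G v x ≡ does (u ≟ x))

K₂Component-swap : (G : Graph n) {u v : Fin n} → K₂Component G u v → K₂Component G v u
K₂Component-swap G (ku , kv) = kv , ku

localComp-K₂-row : (G : Graph n) {u v : Fin n} → K₂Component G u v →
                   ∀ x y → localComp (adj G) x u y ≡ adj G u y
localComp-K₂-row G {u} {v} (ku , kv) x y with v ≟ x
... | no  v≢x  = localComp-outside (adj G) (trans (Graph.sym G x u) (trans (ku x) (dec-false (v ≟ x) v≢x))) y
... | yes refl with u ≟ y
...   | yes refl = refl
...   | no  u≢y  rewrite trans (kv y) (dec-false (u ≟ y) u≢y) | ∧-zeroʳ (adj G v u) = xor-identityʳ (adj G u y)

localComp-K₂ : (G : Graph n) {u v : Fin n} → K₂Component G u v → ∀ x → K₂Component (localCompGraph G x) u v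
localComp-K₂ G k x = (λ y → trans (localComp-K₂-row G k x y) (proj₁ k y)) ,
                     (λ y → trans (localComp-K₂-row G (K₂Component-swap G k) x y) (proj₂ k y))

localComp-K₂⁻ : (G : Graph n) {u v : Fin n} (x : Fin n) → K₂Component (localCompGraph G x) u v → K₂Component G u v
localComp-K₂⁻ G x k with localComp-K₂ (localCompGraph G x) k x
... | ku , kv = (λ y → trans (sym (localComp-involutive G x _ y)) (ku y)) ,
                (λ y → trans (sym (localComp-involutive G x _ y)) (kv y))

localComps-K₂ : (G : Graph n) {u v : Fin n} → K₂Component G u v → ∀ vs → K₂Component (localComps G vs) u v
localComps-K₂ G k []       = k
localComps-K₂ G k (x ∷ vs) = localComp-K₂ (localComps G vs) (localComps-K₂ G k vs) x

localComps-K₂⁻ : (G : Graph n) {u v : Fin n} (vs : List (Fin n)) →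
                 K₂Component (localComps G vs) u v → K₂Component G u v
localComps-K₂⁻ G []       k = k
localComps-K₂⁻ G (x ∷ vs) k = localComps-K₂⁻ G vs (localComp-K₂⁻ (localComps G vs) x k)

record EnumeratesOthers (u v : Fin n) (e : Fin m → Fin n) : Set where
  field
    injective : Injective _≡_ _≡_ e
    ≢u        : ∀ i → e i ≢ u
    ≢v        : ∀ i → e i ≢ v
    onto      : ∀ x → x ≢ u → x ≢ v → ∃[ i ] e i ≡ x

localComp-induced : (G : Graph n) {e : Fin m → Fin n} → Injective _≡_ _≡_ e →
                    ∀ x i j → localComp (adj G) (e x) (e i) (e j) ≡ localComp (adj (induced G e)) x i j
localComp-induced G {e} e-inj x i j with e i ≟ e j | i ≟ j
... | yes _   | yes _    = refl
... | no  _   | no  _    = refl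
... | yes eij | no  i≢j  = ⊥-elim (i≢j (e-inj eij))
... | no  ne  | yes refl = ⊥-elim (ne refl)

localComp-K₂-away : (G : Graph n) {u v y : Fin n} → K₂Component G u v → v ≢ y →
                    ∀ z → localComp (adj G) u y z ≡ adj G y z
localComp-K₂-away G {v = v} {y} (ku , _) v≢y = localComp-outside (adj G) (trans (ku y) (dec-false (v ≟ y) v≢y))

-- Local complementations at u or v do not touch the other vertices, and
-- those at other vertices commute with restricting to the other vertices.
induced-localComps-K₂ : (G : Graph n) {u v : Fin n} {e : Fin m → Fin n} →
                        K₂Component G u v → EnumeratesOthers u v e →
                        ∀ vs → ∃[ ws ] induced (localComps G vs) e ≈ localComps (induced G e) ws
induced-localComps-K₂ G k enum []       = [] , λ _ _ → refl
induced-localComps-K₂ G {u} {v} {e} k enum (x ∷ vs) =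
  let ws , ≈ws = induced-localComps-K₂ G k enum vs in step ws ≈ws (x ≟ u) (x ≟ v)
  where
  open EnumeratesOthers enum
  H = localComps G vs
  kH = localComps-K₂ G k vs
  step : ∀ ws → induced H e ≈ localComps (induced G e) ws → Dec (x ≡ u) → Dec (x ≡ v) →
         ∃[ ws′ ] induced (localCompGraph H x) e ≈ localComps (induced G e) ws′
  step ws ≈ws (yes refl) _          =
    ws , λ i j → trans (localComp-K₂-away H kH (≢v i ∘ sym) (e j)) (≈ws i j)
  step ws ≈ws (no  _)    (yes refl) =
    ws , λ i j → trans (localComp-K₂-away H (K₂Component-swap H kH) (≢u i ∘ sym) (e j)) (≈ws i j)
  step ws ≈ws (no  x≢u)  (no  x≢v)  =
    let x′ , ex′≡x = onto x x≢u x≢v in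
    x′ ∷ ws , λ i j → trans (cong (λ y → localComp (adj H) y (e i) (e j)) (sym ex′≡x))
                           (trans (localComp-induced H injective x′ i j) (localComp-cong ≈ws x′ i j))

avgCutRank-induced-localComps-K₂ : (G : Graph n) {u v : Fin n} {e : Fin m → Fin n} →
  K₂Component G u v → EnumeratesOthers u v e →
  ∀ vs → avgCutRank (induced (localComps G vs) e) ℚ.≤ avgCutRank (induced G e)
avgCutRank-induced-localComps-K₂ G {e = e} k enum vs =
  let ws , ≈ws = induced-localComps-K₂ G k enum vs in
  subst (ℚ._≤ avgCutRank (induced G e))
        (sym (avgCutRank-cong (induced (localComps G vs) e) (localComps (induced G e) ws) ≈ws))
        (avgCutRank-localComps-≤ (induced G e) ws)

punchIn²-enumeratesOthers : (v : Fin (suc (suc n))) (u′ : Fin (suc n)) →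
                            EnumeratesOthers (punchIn v u′) v (punchIn v ∘ punchIn u′)
punchIn²-enumeratesOthers v u′ = record
  { injective = λ {i} {j} eq → punchIn-injective u′ i j (punchIn-injective v _ _ eq)
  ; ≢u        = λ i eq → punchInᵢ≢i u′ i (punchIn-injective v _ _ eq)
  ; ≢v        = λ i → punchInᵢ≢i v (punchIn u′ i)
  ; onto      = onto
  }
  where
  onto : ∀ x → x ≢ punchIn v u′ → x ≢ v → ∃[ i ] punchIn v (punchIn u′ i) ≡ x
  onto x x≢u x≢v = punchOut u′≢x′ , trans (cong (punchIn v) (punchIn-punchOut u′≢x′)) (punchIn-punchOut v≢x)
    where
    v≢x : v ≢ x
    v≢x = x≢v ∘ sym
    u′≢x′ : u′ ≢ punchOut v≢x
    u′≢x′ eq = x≢u (sym (trans (cong (punchIn v) eq) (punchIn-punchOut v≢x)))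

K₂Component-partner : (G : Graph n) {u v x : Fin n} → K₂Component G u v → adj G u x ≡ true → x ≡ v
K₂Component-partner G {u} {v} {x} (ku , _) ux with v ≟ x
... | yes v≡x = sym v≡x
... | no  v≢x with () ← trans (sym ux) (trans (ku x) (dec-false (v ≟ x) v≢x))

K₂Component-induced-noIsolated : (G : Graph n) {u v : Fin n} {e : Fin m → Fin n} → NoIsolated G →
                                 K₂Component G u v → EnumeratesOthers u v e → NoIsolated (induced G e)
K₂Component-induced-noIsolated G {u} {v} {e} noIso k enum i =
  let w , eiw = noIso (e i)
      j , ej≡w = onto w (neighbour≢ k (≢v i) eiw) (neighbour≢ (K₂Component-swap G k) (≢u i) eiw)
  in j , trans (cong (adj G (e i)) ej≡w) eiw
  where
  open EnumeratesOthers enum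
  neighbour≢ : ∀ {u v w} → K₂Component G u v → e i ≢ v → adj G (e i) w ≡ true → w ≢ u
  neighbour≢ {u} k ei≢v eiw refl = ei≢v (K₂Component-partner G k (trans (Graph.sym G u (e i)) eiw))

plusK2-↑ˡ↑ˡ : (H : Graph n) (a b : Fin n) → plusK2 H (a ↑ˡ 2) (b ↑ˡ 2) ≡ adj H a b
plusK2-↑ˡ↑ˡ {n} H a b rewrite splitAt-↑ˡ n a 2 | splitAt-↑ˡ n b 2 = refl

plusK2-↑ʳ↑ʳ : (H : Graph n) (a b : Fin 2) → plusK2 H (n ↑ʳ a) (n ↑ʳ b) ≡ not (does (a ≟ b))
plusK2-↑ʳ↑ʳ {n} H a b rewrite splitAt-↑ʳ n 2 a | splitAt-↑ʳ n 2 b = refl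

plusK2-↑ˡ↑ʳ : (H : Graph n) (a : Fin n) (b : Fin 2) → plusK2 H (a ↑ˡ 2) (n ↑ʳ b) ≡ false
plusK2-↑ˡ↑ʳ {n} H a b rewrite splitAt-↑ˡ n a 2 | splitAt-↑ʳ n 2 b = refl

plusK2-↑ʳ↑ˡ : (H : Graph n) (a : Fin 2) (b : Fin n) → plusK2 H (n ↑ʳ a) (b ↑ˡ 2) ≡ false
plusK2-↑ʳ↑ˡ {n} H a b rewrite splitAt-↑ʳ n 2 a | splitAt-↑ˡ n b 2 = refl

module _ {u v : Fin (suc (suc n))} {e : Fin n → Fin (suc (suc n))}
         (u≢v : u ≢ v) (enum : EnumeratesOthers u v e) where

  open EnumeratesOthers enum

  private
    data Position (x : Fin (suc (suc n))) : Set where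
      at-u : u ≡ x → Position x
      at-v : v ≡ x → Position x
      at-e : ∀ i → e i ≡ x → Position x

    position : ∀ x → Position x
    position x with u ≟ x | v ≟ x
    ... | yes u≡x | _       = at-u u≡x
    ... | no  _   | yes v≡x = at-v v≡x
    ... | no  u≢x | no  v≢x = let i , ei≡x = onto x (u≢x ∘ sym) (v≢x ∘ sym) in at-e i ei≡x

    to : Fin (suc (suc n)) → Fin (n + 2)
    to x with position x
    ... | at-u _   = n ↑ʳ zero
    ... | at-v _   = n ↑ʳ suc zero
    ... | at-e i _ = i ↑ˡ 2

    from : Fin (n + 2) → Fin (suc (suc n))
    from y with splitAt n y
    ... | inj₁ i          = e i
    ... | inj₂ zero       = u
    ... | inj₂ (suc zero) = v

    to-u : to u ≡ n ↑ʳ zero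
    to-u with position u
    ... | at-u _      = refl
    ... | at-v v≡u    = ⊥-elim (u≢v (sym v≡u))
    ... | at-e i ei≡u = ⊥-elim (≢u i ei≡u)

    to-v : to v ≡ n ↑ʳ suc zero
    to-v with position v
    ... | at-u u≡v    = ⊥-elim (u≢v u≡v)
    ... | at-v _      = refl
    ... | at-e i ei≡v = ⊥-elim (≢v i ei≡v)

    to-e : ∀ i → to (e i) ≡ i ↑ˡ 2
    to-e i with position (e i)
    ... | at-u u≡ei    = ⊥-elim (≢u i (sym u≡ei))
    ... | at-v v≡ei    = ⊥-elim (≢v i (sym v≡ei))
    ... | at-e j ej≡ei = cong (_↑ˡ 2) (injective ej≡ei)

    from-to : ∀ x → from (to x) ≡ x
    from-to x with position x
    ... | at-u refl   rewrite splitAt-↑ʳ n 2 zero       = refl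
    ... | at-v refl   rewrite splitAt-↑ʳ n 2 (suc zero) = refl
    ... | at-e i refl rewrite splitAt-↑ˡ n i 2          = refl

    to-from : ∀ y → to (from y) ≡ y
    to-from y = trans (to-from-split (splitAt n y) refl) (join-splitAt n 2 y)
      where
      to-from-split : ∀ s → splitAt n y ≡ s → to (from y) ≡ join n 2 s
      to-from-split s eq with splitAt n y
      to-from-split (inj₁ i)          refl | _ = to-e i
      to-from-split (inj₂ zero)       refl | _ = to-u
      to-from-split (inj₂ (suc zero)) refl | _ = to-v

  K₂Component⇒IsoTo-plusK2 : (G : Graph (suc (suc n))) → K₂Component G u v → IsoTo G (plusK2 (induced G e))
  K₂Component⇒IsoTo-plusK2 G (ku , kv) = mk↔ₛ′ to from to-from from-to , adjacency
    where
    H = induced G e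
    u-e : ∀ i → adj G u (e i) ≡ false
    u-e i = trans (ku (e i)) (dec-false (v ≟ e i) (≢v i ∘ sym))
    v-e : ∀ i → adj G v (e i) ≡ false
    v-e i = trans (kv (e i)) (dec-false (u ≟ e i) (≢u i ∘ sym))
    adjacency : ∀ x y → adj G x y ≡ plusK2 H (to x) (to y)
    adjacency x y with position x | position y
    ... | at-u refl   | at-u refl   = trans (irrefl G u) (sym (plusK2-↑ʳ↑ʳ H zero zero))
    ... | at-u refl   | at-v refl   = trans (ku v) (trans (dec-true (v ≟ v) refl) (sym (plusK2-↑ʳ↑ʳ H zero (suc zero))))
    ... | at-v refl   | at-u refl   = trans (kv u) (trans (dec-true (u ≟ u) refl) (sym (plusK2-↑ʳ↑ʳ H (suc zero) zero)))
    ... | at-v refl   | at-v refl   = trans (irrefl G v) (sym (plusK2-↑ʳ↑ʳ H (suc zero) (suc zero)))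
    ... | at-u refl   | at-e j refl = trans (u-e j) (sym (plusK2-↑ʳ↑ˡ H zero j))
    ... | at-v refl   | at-e j refl = trans (v-e j) (sym (plusK2-↑ʳ↑ˡ H (suc zero) j))
    ... | at-e i refl | at-u refl   = trans (Graph.sym G (e i) u) (trans (u-e i) (sym (plusK2-↑ˡ↑ʳ H i zero)))
    ... | at-e i refl | at-v refl   = trans (Graph.sym G (e i) v) (trans (v-e i) (sym (plusK2-↑ˡ↑ʳ H i (suc zero))))
    ... | at-e i refl | at-e j refl = sym (plusK2-↑ˡ↑ˡ H i j)

-- Finitely many graphs are locally equivalent to a given one

bit : Bool → Fin 2
bit false = zero
bit true  = suc zero

bit-injective : ∀ {a b} → bit a ≡ bit b → a ≡ b
bit-injective {false} {false} _ = refl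
bit-injective {true}  {true}  _ = refl

adjCode : Adj n → Fin ((2 ^ n) ^ n)
adjCode A = funToFin (λ i → funToFin (bit ∘ A i))

adjCode-injective : (A B : Adj n) → adjCode A ≡ adjCode B → ∀ i j → A i j ≡ B i j
adjCode-injective A B eq i j = bit-injective (begin
  bit (A i j)                         ≡⟨ finToFun-funToFin (bit ∘ A i) j ⟨
  finToFun (funToFin (bit ∘ A i)) j   ≡⟨ cong (λ c → finToFun c j) (finToFun-funToFin _ i) ⟨
  finToFun (finToFun (adjCode A) i) j ≡⟨ cong (λ c → finToFun (finToFun c i) j) eq ⟩
  finToFun (finToFun (adjCode B) i) j ≡⟨ cong (λ c → finToFun c j) (finToFun-funToFin _ i) ⟩
  finToFun (funToFin (bit ∘ B i)) j   ≡⟨ finToFun-funToFin (bit ∘ B i) j ⟩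
  bit (B i j)                         ∎)
  where open ≡-Reasoning

private
  cut-length : ∀ {i j K} → i ℕ.< j → j ≤ suc K → i + (suc K ∸ j) ≤ K
  cut-length {i} {j} {K} i<j j≤ = ≤-pred (subst (suc i + (suc K ∸ j) ≤_) (m+[n∸m]≡n j≤) (+-monoˡ-≤ _ i<j))

module _ (G : Graph n) where

  private
    K : ℕ
    K = (2 ^ n) ^ n

  -- Among the K + 1 suffixes of a sequence of length K + 1 two lead to the
  -- same graph, so the steps between them can be cut out.
  localComps-cut : ∀ ws → length ws ≡ suc K → ∃[ ws′ ] length ws′ ≤ K × localComps G ws′ ≈ localComps G ws
  localComps-cut ws len with pigeonhole (n<1+n K) (λ k → adjCode (adj (localComps G (drop (toℕ k) ws))))
  ... | i , j , i<j , same = take (toℕ i) ws ++ drop (toℕ j) ws , shorter , equivalent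
    where
    shorter : length (take (toℕ i) ws ++ drop (toℕ j) ws) ≤ K
    shorter rewrite ListP.length-++ (take (toℕ i) ws) {drop (toℕ j) ws}
                  | ListP.length-take (toℕ i) ws | ListP.length-drop (toℕ j) ws | len =
      ≤-trans (+-monoˡ-≤ _ (m⊓n≤m (toℕ i) (suc K))) (cut-length i<j (m≤n⇒m≤1+n (toℕ≤pred[n] j)))
    equivalent : localComps G (take (toℕ i) ws ++ drop (toℕ j) ws) ≈ localComps G ws
    equivalent a b = begin
      adj (localComps G (take (toℕ i) ws ++ drop (toℕ j) ws)) a b
        ≡⟨ cong (λ H → adj H a b) (localComps-++ G (take (toℕ i) ws) (drop (toℕ j) ws)) ⟩
      adj (localComps (localComps G (drop (toℕ j) ws)) (take (toℕ i) ws)) a b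
        ≡⟨ localComps-cong (λ x y → sym (adjCode-injective _ _ same x y)) (take (toℕ i) ws) a b ⟩
      adj (localComps (localComps G (drop (toℕ i) ws)) (take (toℕ i) ws)) a b
        ≡⟨ cong (λ H → adj H a b) (localComps-++ G (take (toℕ i) ws) (drop (toℕ i) ws)) ⟨
      adj (localComps G (take (toℕ i) ws ++ drop (toℕ i) ws)) a b
        ≡⟨ cong (λ vs → adj (localComps G vs) a b) (ListP.take++drop≡id (toℕ i) ws) ⟩
      adj (localComps G ws) a b ∎
      where open ≡-Reasoning

  localComps-shorten : ∀ vs → ∃[ ws ] length ws ≤ K × localComps G ws ≈ localComps G vs
  localComps-shorten []       = [] , z≤n , λ _ _ → refl
  localComps-shorten (v ∷ vs) with localComps-shorten vs
  ... | ws , len , ≈vs with suc (length ws) ℕ.≤? K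
  ...   | yes fits = v ∷ ws , fits , localComp-cong ≈vs v
  ...   | no  full with localComps-cut (v ∷ ws) (cong suc (≤-antisym len (≤-pred (≰⇒> full))))
  ...     | ws′ , len′ , ≈vws = ws′ , len′ , λ a b → trans (≈vws a b) (localComp-cong ≈vs v a b)

  private
    listsUpTo : ℕ → List (List (Fin n))
    listsUpTo zero    = [] ∷ []
    listsUpTo (suc k) = [] ∷ concatMap (λ v → map (v ∷_) (listsUpTo k)) (allFin n)

    ∈-listsUpTo : ∀ k vs → length vs ≤ k → vs ∈ listsUpTo k
    ∈-listsUpTo zero    []       _         = here refl
    ∈-listsUpTo (suc k) []       _         = here refl
    ∈-listsUpTo (suc k) (v ∷ vs) (s≤s len) =
      there (∈-concatMap⁺ (λ w → map (w ∷_) (listsUpTo k))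
               (Any.map (λ { refl → ∈-map⁺ (v ∷_) (∈-listsUpTo k vs len) }) (∈-allFin v)))

  localComps-search : (P : Graph n → Set) → (∀ H → Dec (P H)) → (∀ {H H′} → H ≈ H′ → P H → P H′) →
                      Dec (∃[ vs ] P (localComps G vs))
  localComps-search P P? P-resp with Any.any? (P? ∘ localComps G) (listsUpTo K)
  ... | yes found = yes (satisfied found)
  ... | no  none  = no λ (vs , p) →
    let ws , len , ≈vs = localComps-shorten vs in
    none (Any.map (λ { refl → P-resp (λ a b → sym (≈vs a b)) p }) (∈-listsUpTo K ws len))

missed-vertex : (f : Fin m → Fin n) → Injective _≡_ _≡_ f → m ℕ.< n → ∃[ v ] ∀ i → f i ≢ v
missed-vertex {m} {n} f f-inj m<n with any? (λ v → all? (λ i → ¬? (f i ≟ v)))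
... | yes missed = missed
... | no  ¬missed = ⊥-elim (<⇒≱ m<n (injective⇒≤ g-inj))
  where
  preimage-of : ∀ v → ∃[ i ] f i ≡ v
  preimage-of v with any? (λ i → f i ≟ v)
  ... | yes found = found
  ... | no  none  = ⊥-elim (¬missed (v , λ i fi≡v → none (i , fi≡v)))
  g : Fin n → Fin m
  g = proj₁ ∘ preimage-of
  g-inj : Injective _≡_ _≡_ g
  g-inj {x} {y} eq = trans (sym (proj₂ (preimage-of x))) (trans (cong f eq) (proj₂ (preimage-of y)))

avoiding : (u : Fin (suc n)) (f : Fin m → Fin (suc n)) → (∀ i → f i ≢ u) → Fin m → Fin n
avoiding u f f≢u i = punchOut (f≢u i ∘ sym)

avoiding-injective : (u : Fin (suc n)) {f : Fin m → Fin (suc n)} (f≢u : ∀ i → f i ≢ u) →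
                     Injective _≡_ _≡_ f → Injective _≡_ _≡_ (avoiding u f f≢u)
avoiding-injective u f≢u f-inj eq = f-inj (punchOut-injective (f≢u _ ∘ sym) (f≢u _ ∘ sym) eq)

induced-avoiding : (G : Graph (suc n)) (u : Fin (suc n)) (f : Fin m → Fin (suc n)) (f≢u : ∀ i → f i ≢ u) →
                   induced (G ─ u) (avoiding u f f≢u) ≈ induced G f
induced-avoiding G u f f≢u i j = cong₂ (adj G) (punchIn-punchOut (f≢u i ∘ sym)) (punchIn-punchOut (f≢u j ∘ sym))

induced-properVertexMinor : (G : Graph n) (vs : List (Fin n)) (f : Fin m → Fin n) →
                            Injective _≡_ _≡_ f → m ℕ.< n → ProperVertexMinor (induced (localComps G vs) f) G
induced-properVertexMinor G vs f f-inj m<n =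
  m<n , adj (localComps G vs) , localComps⇒locallyEquiv G vs , f , f-inj , λ _ _ → refl

deletion-properVertexMinor : (G : Graph (suc n)) (vs : List (Fin (suc n))) (v : Fin (suc n)) →
                             ProperVertexMinor (localComps G vs ─ v) G
deletion-properVertexMinor {n} G vs v =
  induced-properVertexMinor G vs (punchIn v) (punchIn-injective v _ _) (n<1+n n)

properVertexMinor-view : {H : Graph m} {G : Graph n} → ProperVertexMinor H G →
  m ℕ.< n × ∃[ vs ] ∃[ f ] Injective _≡_ _≡_ f × H ≈ induced (localComps G vs) f
properVertexMinor-view {G = G} (m<n , B , G~B , f , f-inj , H≈B) with locallyEquiv⇒localComps G G~B
... | vs , refl = m<n , vs , f , f-inj , H≈B

avgCutRank-properVertexMinor-< : {H : Graph m} (G : Graph n) → NoIsolated G → ProperVertexMinor H G →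
                                 avgCutRank H < avgCutRank G
avgCutRank-properVertexMinor-< {H = H} G noIso pvm =
  let m<n , vs , f , f-inj , H≈ = properVertexMinor-view {H = H} {G = G} pvm
      v , f≢v = missed-vertex f f-inj m<n
      B = localComps G vs
      w , vw = localComps-noIsolated G vs noIso v
  in begin-strict
  avgCutRank H             ≡⟨ avgCutRank-cong H (induced B f) H≈ ⟩
  avgCutRank (induced B f) <⟨ avgCutRank-induced-< B f f-inj f≢v vw ⟩
  avgCutRank B             ≤⟨ avgCutRank-localComps-≤ G vs ⟩
  avgCutRank G             ∎
  where open ℚₚ.≤-Reasoning

properVertexMinor-≤-deletion : {H : Graph m} (G : Graph (suc n)) → ProperVertexMinor H G →
                               ∃[ vs ] ∃[ v ] avgCutRank H ℚ.≤ avgCutRank (localComps G vs ─ v)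
properVertexMinor-≤-deletion {H = H} G pvm =
  let m<n , vs , f , f-inj , H≈ = properVertexMinor-view {H = H} {G = G} pvm
      v , f≢v = missed-vertex f f-inj m<n
      B = localComps G vs
      f′ = avoiding v f f≢v
  in vs , v , (begin
  avgCutRank H                ≡⟨ avgCutRank-cong H (induced B f) H≈ ⟩
  avgCutRank (induced B f)    ≡⟨ avgCutRank-cong (induced (B ─ v) f′) (induced B f) (induced-avoiding B v f f≢v) ⟨
  avgCutRank (induced (B ─ v) f′) ≤⟨ avgCutRank-induced-≤ (B ─ v) f′ (avoiding-injective v f≢v f-inj) ⟩
  avgCutRank (B ─ v)          ∎)
  where open ℚₚ.≤-Reasoning

isolated⇒properVertexMinor-≥ : (G : Graph n) (v : Fin n) → Isolated G v →
  ∃[ m ] Σ (Graph m) λ H → ProperVertexMinor H G × avgCutRank G ℚ.≤ avgCutRank H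
isolated⇒properVertexMinor-≥ {suc n} G v v-isolated =
  n , G ─ v , deletion-properVertexMinor G [] v , avgCutRank-delete-isolated G v v-isolated

noIsolated⊎properVertexMinor-≥ : (G : Graph n) →
  NoIsolated G ⊎ ∃[ m ] Σ (Graph m) λ H → ProperVertexMinor H G × avgCutRank G ℚ.≤ avgCutRank H
noIsolated⊎properVertexMinor-≥ G =
  map₂ (λ (v , v-isolated) → isolated⇒properVertexMinor-≥ G v v-isolated) (noIsolated⊎isolated G)

-- The classes 𝓛_{≤α} and 𝓛_{<α}

<-irreflexive : {p : ℚ} → ¬ p < p
<-irreflexive p<p = ℚₚ.<-asym p<p p<p

module _ (α : ℚ) where

  noIsolated⇒InLt : (G : Graph n) → NoIsolated G → avgCutRank G ≡ α → InLt α G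
  noIsolated⇒InLt G noIso avg≡α =
    ℚₚ.≤-reflexive (sym avg≡α) ,
    λ _ H pvm → subst (avgCutRank H <_) avg≡α (avgCutRank-properVertexMinor-< {H = H} G noIso pvm)

  InLt⇒noIsolated : (G : Graph n) → InLt α G → NoIsolated G
  InLt⇒noIsolated G (α≤G , below) = [ id , (λ (m , H , pvm , G≤H) →
    ⊥-elim (<-irreflexive (ℚₚ.≤-<-trans (ℚₚ.≤-trans α≤G G≤H) (below m H pvm)))) ]′
    (noIsolated⊎properVertexMinor-≥ G)

  InLe⇒noIsolated : (G : Graph n) → InLe α G → NoIsolated G
  InLe⇒noIsolated G (α<G , below) = [ id , (λ (m , H , pvm , G≤H) →
    ⊥-elim (<-irreflexive (ℚₚ.<-≤-trans (ℚₚ.<-≤-trans α<G G≤H) (below m H pvm)))) ]′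
    (noIsolated⊎properVertexMinor-≥ G)

  InLt∖InLe⇒avg≡ : (G : Graph n) → InLt α G → ¬ InLe α G → avgCutRank G ≡ α
  InLt∖InLe⇒avg≡ G (α≤G , below) ¬le =
    ℚₚ.≤-antisym (ℚₚ.≮⇒≥ λ α<G → ¬le (α<G , λ _ H pvm → ℚₚ.<⇒≤ (below _ H pvm))) α≤G

  DeletionAbove : Graph (suc n) → Set
  DeletionAbove H = ∃[ v ] α ℚ.≤ avgCutRank (H ─ v)

  deletionAbove? : (H : Graph (suc n)) → Dec (DeletionAbove H)
  deletionAbove? H = any? λ v → α ℚ.≤? avgCutRank (H ─ v)

  deletionAbove-resp : {H H′ : Graph (suc n)} → H ≈ H′ → DeletionAbove H → DeletionAbove H′
  deletionAbove-resp {H = H} {H′} H≈H′ (v , α≤) =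
    v , subst (α ℚ.≤_) (avgCutRank-cong (H ─ v) (H′ ─ v) (λ i j → H≈H′ (punchIn v i) (punchIn v j))) α≤

  -- A graph none of whose locally equivalent graphs has such a deletion would
  -- lie in 𝓛_{<α}; deciding this needs the finiteness of the search.
  ¬InLt⇒deletionAbove : (G : Graph (suc n)) → InLe α G → ¬ InLt α G → ∃[ vs ] DeletionAbove (localComps G vs)
  ¬InLt⇒deletionAbove {n} G (α<G , _) ¬lt =
    decided (localComps-search G DeletionAbove deletionAbove? (λ {H} {H′} → deletionAbove-resp {H = H} {H′}))
    where
    decided : Dec (∃[ vs ] DeletionAbove (localComps G vs)) → ∃[ vs ] DeletionAbove (localComps G vs)
    decided (yes found) = found
    decided (no  none)  = ⊥-elim (¬lt (ℚₚ.<⇒≤ α<G , below))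
      where
      below : ∀ m (H : Graph m) → ProperVertexMinor H G → avgCutRank H < α
      below _ H pvm =
        let vs , v , H≤ = properVertexMinor-≤-deletion {H = H} G pvm
        in ℚₚ.≤-<-trans H≤ (ℚₚ.≰⇒> {α} {avgCutRank (localComps G vs ─ v)} λ α≤ → none (vs , v , α≤))

  TightMinor : Graph n → Set
  TightMinor {n} G = ∃[ m ] Σ (Graph m) (λ H →
    ProperVertexMinor H G × InLt α H × avgCutRank H ≡ α × n ∸ m ≤ 2 × (n ∸ m ≡ 2 → IsoTo G (plusK2 H)))

  tightMinor-by-deletion : (G : Graph (suc n)) (vs : List (Fin (suc n))) (v : Fin (suc n)) →
                           avgCutRank (localComps G vs ─ v) ≡ α → NoIsolated (localComps G vs ─ v) → TightMinor G
  tightMinor-by-deletion {n} G vs v avg≡α noIso =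
    n , H , deletion-properVertexMinor G vs v , noIsolated⇒InLt H noIso avg≡α , avg≡α ,
    subst (_≤ 2) (sym (m+n∸n≡m 1 n)) (s≤s z≤n) , λ 1≡2 → contradiction (trans (sym (m+n∸n≡m 1 n)) 1≡2) λ ()
    where H = localComps G vs ─ v

  module _ (G : Graph (suc (suc n))) (noIso : NoIsolated G)
           (below : ∀ m (H : Graph m) → ProperVertexMinor H G → avgCutRank H ℚ.≤ α)
           (vs : List (Fin (suc (suc n)))) (v : Fin (suc (suc n))) (u′ : Fin (suc n))
           (avg≡α : avgCutRank (localComps G vs ─ v) ≡ α) (u′-isolated : Isolated (localComps G vs ─ v) u′) where

    private
      B = localComps G vs
      u = punchIn v u′
      e = punchIn v ∘ punchIn u′
      enum = punchIn²-enumeratesOthers v u′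

    -- The only possible neighbour of u in B is v; if v had another neighbour w
    -- then deleting v from B ─ u would lower its average below α.
    isolated-after-deletion⇒K₂ : K₂Component B u v
    isolated-after-deletion⇒K₂ = row-u , row-v
      where
      u≢v : u ≢ v
      u≢v = punchInᵢ≢i v u′
      off-v : ∀ {x} → v ≢ x → adj B u x ≡ false
      off-v v≢x = trans (cong (adj B u) (sym (punchIn-punchOut v≢x))) (u′-isolated (punchOut v≢x))
      neighbour-is-v : ∀ {w} → Dec (v ≡ w) → adj B u w ≡ true → adj B u v ≡ true
      neighbour-is-v (yes refl) uw = uw
      neighbour-is-v (no  v≢w)  uw = contradiction (trans (sym uw) (off-v v≢w)) λ ()
      uv : adj B u v ≡ true
      uv = let w , uw = localComps-noIsolated G vs noIso u in neighbour-is-v (v ≟ w) uw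
      row-u′ : ∀ {x} (v≟x : Dec (v ≡ x)) → adj B u x ≡ does v≟x
      row-u′ (yes refl) = uv
      row-u′ (no  v≢x)  = off-v v≢x
      row-u : ∀ x → adj B u x ≡ does (v ≟ x)
      row-u x = row-u′ (v ≟ x)
      v-only-u : ∀ {w} → u ≢ w → ¬ adj B v w ≡ true
      v-only-u {w} u≢w vw = <-irreflexive (begin-strict
        α                               ≡⟨ sym avg≡α ⟩
        avgCutRank (B ─ v)              ≤⟨ avgCutRank-delete-isolated (B ─ v) u′ u′-isolated ⟩
        avgCutRank ((B ─ v) ─ u′)       ≡⟨ avgCutRank-cong ((B ─ v) ─ u′) (induced B e) (λ _ _ → refl) ⟩
        avgCutRank (induced B e)
          ≡⟨ avgCutRank-cong (induced (B ─ u) g) (induced B e) (induced-avoiding B u e e≢u) ⟨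
        avgCutRank (induced (B ─ u) g)
          <⟨ avgCutRank-induced-< (B ─ u) g (avoiding-injective u e≢u e-inj) g≢v̂ v̂ŵ ⟩
        avgCutRank (B ─ u)              ≤⟨ below (suc n) (B ─ u) (deletion-properVertexMinor G vs u) ⟩
        α                               ∎)
        where
        open ℚₚ.≤-Reasoning
        open EnumeratesOthers enum renaming (injective to e-inj; ≢u to e≢u; ≢v to e≢v)
        g = avoiding u e e≢u
        g≢v̂ : ∀ i → g i ≢ punchOut u≢v
        g≢v̂ i eq = e≢v i (trans (sym (punchIn-punchOut (e≢u i ∘ sym)))
                                (trans (cong (punchIn u) eq) (punchIn-punchOut u≢v)))
        v̂ŵ : adj (B ─ u) (punchOut u≢v) (punchOut u≢w) ≡ true
        v̂ŵ = trans (cong₂ (adj B) (punchIn-punchOut u≢v) (punchIn-punchOut u≢w)) vw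
      row-v′ : ∀ {x} (u≟x : Dec (u ≡ x)) → adj B v x ≡ does u≟x
      row-v′ (yes refl) = trans (Graph.sym B v u) uv
      row-v′ (no  u≢x)  = ¬-not (v-only-u u≢x)
      row-v : ∀ x → adj B v x ≡ does (u ≟ x)
      row-v x = row-v′ (u ≟ x)

    tightMinor-by-K₂ : TightMinor G
    tightMinor-by-K₂ =
      n , H , pvm , noIsolated⇒InLt H noIsoH avgH≡α , avgH≡α , ℕₚ.≤-reflexive (m+n∸n≡m 2 n) ,
      λ _ → K₂Component⇒IsoTo-plusK2 (punchInᵢ≢i v u′) enum G kG
      where
      kG : K₂Component G u v
      kG = localComps-K₂⁻ G vs isolated-after-deletion⇒K₂
      H = induced G e
      pvm : ProperVertexMinor H G
      pvm = induced-properVertexMinor G [] e (EnumeratesOthers.injective enum) (m≤n⇒m≤1+n (n<1+n n))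
      noIsoH : NoIsolated H
      noIsoH = K₂Component-induced-noIsolated G noIso kG enum
      avgH≡α : avgCutRank H ≡ α
      avgH≡α = ℚₚ.≤-antisym (below n H pvm) (begin
        α                          ≡⟨ sym avg≡α ⟩
        avgCutRank (B ─ v)         ≤⟨ avgCutRank-delete-isolated (B ─ v) u′ u′-isolated ⟩
        avgCutRank ((B ─ v) ─ u′)  ≡⟨ avgCutRank-cong ((B ─ v) ─ u′) (induced B e) (λ _ _ → refl) ⟩
        avgCutRank (induced B e)   ≤⟨ avgCutRank-induced-localComps-K₂ G kG enum vs ⟩
        avgCutRank H               ∎)
        where open ℚₚ.≤-Reasoning

  tightMinor-by-isolated : (G : Graph (suc n)) → NoIsolated G →
    (∀ m (H : Graph m) → ProperVertexMinor H G → avgCutRank H ℚ.≤ α) →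
    ∀ vs v (u′ : Fin n) → avgCutRank (localComps G vs ─ v) ≡ α → Isolated (localComps G vs ─ v) u′ →
    TightMinor G
  tightMinor-by-isolated {suc n} G noIso below vs v u′ avg≡α u′-isolated =
    tightMinor-by-K₂ G noIso below vs v u′ avg≡α u′-isolated

  avg≡⇒¬InLe : (G : Graph n) → avgCutRank G ≡ α → ¬ InLe α G
  avg≡⇒¬InLe G avg≡α (α<G , _) = <-irreflexive (subst (α <_) avg≡α α<G)

  InLe∖InLt⇒tightMinor : (G : Graph n) → 0ℚ < α → InLe α G → ¬ InLt α G → TightMinor G
  -- The graph on no vertices has average cut-rank 0; this is where α > 0 is used.
  InLe∖InLt⇒tightMinor {zero}  G 0<α (α<G , _) _ = ⊥-elim (ℚₚ.<-asym 0<α α<G)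
  InLe∖InLt⇒tightMinor {suc n} G _ le ¬lt =
    let vs , v , α≤ = ¬InLt⇒deletionAbove G le ¬lt
        B─v = localComps G vs ─ v
        avg≡α = ℚₚ.≤-antisym (proj₂ le n B─v (deletion-properVertexMinor G vs v)) α≤
    in [ tightMinor-by-deletion G vs v avg≡α ,
         (λ (u′ , u′-isolated) →
            tightMinor-by-isolated G (InLe⇒noIsolated G le) (proj₂ le) vs v u′ avg≡α u′-isolated)
       ]′ (noIsolated⊎isolated B─v)

lemma7p10 : (α : ℚ) → 0ℚ < α →
  -- (1)  G ∈ 𝓛_{<α} \ 𝓛_{≤α}  iff  G has no isolated vertices and 𝔼ρ(G) = α
  ((n : ℕ) (G : Graph n) →
    (InLt α G × ¬ InLe α G) ⇔ (NoIsolated G × avgCutRank G ≡ α))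
  ×
  -- (2)
  ((n : ℕ) (G : Graph n) → InLe α G → ¬ InLt α G →
    ∃[ m ] Σ (Graph m) (λ H →
      ProperVertexMinor H G
      × InLt α H
      × avgCutRank H ≡ α
      × n ∸ m ≤ 2
      × (n ∸ m ≡ 2 → IsoTo G (plusK2 H))))
lemma7p10 α 0<α =
  (λ n G → mk⇔ (λ (lt , ¬le) → InLt⇒noIsolated α G lt , InLt∖InLe⇒avg≡ α G lt ¬le)
               (λ (noIso , avg≡α) → noIsolated⇒InLt α G noIso avg≡α , avg≡⇒¬InLe α G avg≡α)) ,
  (λ n G → InLe∖InLt⇒tightMinor α G 0<α)
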